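{- Let $d$ be a positive integer, let $k$ be an integer sufficiently large in terms of $d$, and let $n$ be sufficiently large in terms of $k$ (the paper writes $d\ll k\ll n$). Let $T$ be a subdivision tree on $n$ vertices in which every vertex has degree at most $d$. Then there exists a system $\mathcal{E}$ of $e$ stars $E_j=\{\{v_{j,i},w_{j,i},u_j\}:1\le i\le \deg_T(u_j)\}\subseteq E(T)$, $j=1,\dots,e$, such that the hypergraph obtained from $T$ by deleting all edges of all stars in $\mathcal{E}$ consists of a set $I$ of isolated vertices together with a set $\mathcal{P}$ of $l$ vertex-disjoint subhypertrees (some of which may consist of a single vertex), with $V(T)=I\cup\bigcup_{P\in\mathcal P}V(P)$ a disjoint union, satisfying: (1) $|V(P)|\le k$ for every $P\in\mathcal{P}$; (2) $|I|\le \frac{2d^2}{k}\,n$; (3) $|I|\ge|\mathcal{P}|=l$; (4) $l\ge|\mathcal{E}|=e$; (5) $l\ge \frac{n}{k+3}$; (6) $I=\bigcup_{j=1}^{e}\{w_{j,1},w_{j,2},\dots,w_{j,\deg_T(u_j)},u_j\}$, and $v_{j,i}\notin I$ for all $i,j$.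
   Context: A hypertree is a connected, simple $3$-uniform hypergraph in which every two vertices are joined by a unique path. A subdivision tree is a hypertree in which each edge contains a vertex of degree one. A star in a $3$-uniform hypergraph $G$ centered at a vertex $u$ is the set of all edges $\{v_i,w_i,u\}\in E(G)$, $1\le i\le c=\deg_G(u)$, where all the vertices $v_i,w_i,u$ ($1\le i\le c$) are distinct, so any two of these edges intersect exactly in $u$. -}

module Defs where

open import Data.Nat using (ℕ; zero; suc; _+_; _*_; _≤_)
open import Data.Fin using (Fin)
open import Data.Fin.Properties using (_≟_)
import Data.Fin.Subset as S
open import Data.Product using (Σ; ∃; _×_; _,_; proj₁; proj₂)
open import Data.Sum using (_⊎_)
open import Data.Unit using (⊤)
open import Data.List using (List; []; _∷_; map; length; filter; allFin; lookup; _++_)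
open import Data.List.Relation.Unary.Unique.Propositional using (Unique)
open import Data.List.Membership.Propositional using (_∈_)
open import Data.Maybe using (Maybe; just; nothing)
import Data.Maybe.Properties as MP
open import Relation.Binary.PropositionalEquality using (_≡_; _≢_)
open import Relation.Nullary using (¬_; Dec)
open import Relation.Nullary.Decidable using (_⊎-dec_)

-- 3-uniform hypergraphs on the vertex set Fin n.
-- An edge is written as an (ordered) triple; its vertex set is what matters.

Edge : ℕ → Set
Edge n = Fin n × Fin n × Fin n

_∈ₑ_ : ∀ {n} → Fin n → Edge n → Set
v ∈ₑ (a , b , c) = v ≡ a ⊎ v ≡ b ⊎ v ≡ c

_∈ₑ?_ : ∀ {n} (v : Fin n) (e : Edge n) → Dec (v ∈ₑ e)
v ∈ₑ? (a , b , c) = (v ≟ a) ⊎-dec ((v ≟ b) ⊎-dec (v ≟ c))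

_≈ₑ_ : ∀ {n} → Edge n → Edge n → Set
e ≈ₑ f = ∀ v → (v ∈ₑ e → v ∈ₑ f) × (v ∈ₑ f → v ∈ₑ e)

record Hypergraph3 (n : ℕ) : Set where
  field
    edges : List (Edge n)
open Hypergraph3 public

Is3Edge : ∀ {n} → Edge n → Set
Is3Edge (a , b , c) = a ≢ b × a ≢ c × b ≢ c

IsSimple3Uniform : ∀ {n} → Hypergraph3 n → Set
IsSimple3Uniform G =
  (∀ i → Is3Edge (lookup (edges G) i)) ×
  (∀ i j → lookup (edges G) i ≈ₑ lookup (edges G) j → i ≡ j)

deg : ∀ {n} → Hypergraph3 n → Fin n → ℕ
deg G v = length (filter (v ∈ₑ?_) (edges G))

-- (Berge) paths: x₀ e₁ x₁ e₂ … eₘ xₘ with distinct vertices, distinct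
-- edges, x_{i-1}, x_i ∈ e_i.  A path is given by its start vertex and the
-- list of steps (eᵢ , xᵢ); the edges are taken from an edge predicate H.

lastV : ∀ {n} → Fin n → List (Edge n × Fin n) → Fin n
lastV x [] = x
lastV x ((e , y) ∷ s) = lastV y s

ValidSteps : ∀ {n} → (Edge n → Set) → Fin n → List (Edge n × Fin n) → Set
ValidSteps H x [] = ⊤
ValidSteps H x ((e , y) ∷ s) = H e × x ∈ₑ e × y ∈ₑ e × ValidSteps H y s

IsPath : ∀ {n} → (Edge n → Set) → Fin n → Fin n → List (Edge n × Fin n) → Set
IsPath H x y s =
  ValidSteps H x s × lastV x s ≡ y ×
  Unique (x ∷ map proj₂ s) × Unique (map proj₁ s)

IsHypertreeOn : ∀ {n} → (Fin n → Set) → (Edge n → Set) → Set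
IsHypertreeOn V H =
  (∀ e → H e → ∀ v → v ∈ₑ e → V v) ×
  (∀ x y → V x → V y → ∃ λ s → IsPath H x y s) ×
  (∀ x y s t → IsPath H x y s → IsPath H x y t → s ≡ t)

IsHypertree : ∀ {n} → Hypergraph3 n → Set
IsHypertree G = IsSimple3Uniform G × IsHypertreeOn (λ _ → ⊤) (λ e → e ∈ edges G)

IsSubdivisionTree : ∀ {n} → Hypergraph3 n → Set
IsSubdivisionTree G =
  IsHypertree G × (∀ e → e ∈ edges G → ∃ λ v → v ∈ₑ e × deg G v ≡ 1)

-- Stars.  The star centred at u, with c = deg G u edges written
-- {vᵢ, wᵢ, u} (i : Fin c), given by legs i = (vᵢ , wᵢ).

IsStar : ∀ {n} (G : Hypergraph3 n) (u : Fin n) →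
         (Fin (deg G u) → Fin n × Fin n) → Set
IsStar G u legs =
  (∀ i → ∃ λ f → f ∈ edges G × f ≈ₑ (proj₁ (legs i) , proj₂ (legs i) , u)) ×
  (∀ f → f ∈ edges G → u ∈ₑ f → ∃ λ i → f ≈ₑ (proj₁ (legs i) , proj₂ (legs i) , u)) ×
  Unique (u ∷ (map (λ i → proj₁ (legs i)) (allFin _) ++ map (λ i → proj₂ (legs i)) (allFin _)))

-- Stars: e stars with pairwise distinct centres center j (so e = |𝓔|),
-- star j has edges {v j i , w j i , center j}, i : Fin (deg T (center j)).
-- Partition: part v ≡ nothing  iff  v ∈ I ; otherwise part v = just p
-- says v ∈ V(P_p), p : Fin l.

record Decomposition (d k n : ℕ) (T : Hypergraph3 n) : Set where
  field
    e       : ℕ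
    center  : Fin e → Fin n
    center-inj : ∀ j j' → center j ≡ center j' → j ≡ j'
    legs    : (j : Fin e) → Fin (deg T (center j)) → Fin n × Fin n
    isStar  : ∀ j → IsStar T (center j) (legs j)

  v : (j : Fin e) → Fin (deg T (center j)) → Fin n
  v j i = proj₁ (legs j i)
  w : (j : Fin e) → Fin (deg T (center j)) → Fin n
  w j i = proj₂ (legs j i)

  Remaining : Edge n → Set
  Remaining f = f ∈ edges T × ¬ (∃ λ j → ∃ λ i → f ≈ₑ (v j i , w j i , center j))

  field
    l     : ℕ
    I     : S.Subset n
    part  : Fin n → Maybe (Fin l)
    part-I   : ∀ x → part x ≡ nothing → x S.∈ I
    I-part   : ∀ x → x S.∈ I → part x ≡ nothing
    part-nonempty : ∀ p → ∃ λ x → part x ≡ just p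
    I-isolated : ∀ x → x S.∈ I → ∀ f → Remaining f → ¬ (x ∈ₑ f)
    edge-inside : ∀ f → Remaining f → ∃ λ p → ∀ x → x ∈ₑ f → part x ≡ just p
    part-tree : ∀ p → IsHypertreeOn (λ x → part x ≡ just p)
                        (λ f → Remaining f × (∀ x → x ∈ₑ f → part x ≡ just p))

  partSize : Fin l → ℕ
  partSize p = length (filter (λ x → MP.≡-dec _≟_ (part x) (just p)) (allFin n))

  field
    cond1 : ∀ p → partSize p ≤ k
    -- (2) |I| ≤ (2d²/k) n, i.e. k·|I| ≤ 2d²n
    cond2 : k * S.∣ I ∣ ≤ 2 * (d * d) * n
    cond3 : l ≤ S.∣ I ∣
    cond4 : e ≤ l
    -- (5) l ≥ n/(k+3)
    cond5 : n ≤ (k + 3) * l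
    cond6a : ∀ x → x S.∈ I → ∃ λ j → x ≡ center j ⊎ ∃ λ i → x ≡ w j i
    cond6b : ∀ j → center j S.∈ I
    cond6c : ∀ j i → w j i S.∈ I
    cond6d : ∀ j i → v j i S.∉ I

-- Root T at a vertex r of degree at least two. Working up from the leaves, a vertex becomes a
-- centre when its region -- the vertices it reaches downwards without crossing an edge through
-- another centre -- has more than K elements; r is always a centre. Delete the stars at the centres,
-- choosing w in each leg to be a second centre of the edge if there is one and a leaf otherwise, and
-- let I be the centres together with these w. What remains falls apart into subtrees, each hanging
-- below a top vertex whose parent edge meets a centre; a part lies in the region of its top, which is
-- not a centre, so it has at most K vertices. Maps with small fibres between centres, tops and I give (3)-(5);
-- (2) follows from |I| ≤ (d + 1)·#centres and the disjointness of the large regions.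

module Submission where

open import Defs
import Data.Nat.Properties as ℕₚ
open import Algebra.Properties.Semiring.Sum ℕₚ.+-*-semiring
  using (sum; sum-syntax; ∑-comm; ∑-distrib-+; *-distribˡ-sum; sum-cong-≗)
open import Data.Nat using (ℕ; zero; suc; _+_; _*_; _≤_; _<_; _<ᵇ_; z≤n; s≤s)
open import Data.Nat.Properties
  using (≤-refl; ≤-reflexive; ≤-trans; _≤?_; <-irrefl; <⇒≱; ≰⇒>; <ᵇ⇒<; <⇒<ᵇ; m≤m+n; m≤n+m; n≤1+n;
         +-comm; +-suc; +-identityʳ; *-comm; *-identityˡ; *-identityʳ; *-zeroʳ; *-distribʳ-+;
         +-mono-≤; +-monoˡ-≤; +-monoʳ-≤; *-monoˡ-≤; *-monoʳ-≤; module ≤-Reasoning)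
open import Data.Bool using (Bool; true; false; _∧_; _∨_; not; if_then_else_)
import Data.Bool as Bool
open import Data.Bool.Properties using (∨-zeroʳ; ∧-zeroʳ; ∧-conicalˡ; ∧-conicalʳ; ∨-conicalˡ; ∨-conicalʳ)
open import Data.Fin using (Fin; zero; suc)
open import Data.Fin.Properties using (_≟_; any?; suc-injective; injective⇒≤; 0≢1+n)
import Data.Fin.Subset as S
open import Data.Product using (∃; _×_; _,_; proj₁; proj₂)
open import Data.Product.Properties using (≡-dec)
open import Data.Sum using (_⊎_; inj₁; inj₂)
open import Data.Unit using (⊤; tt)
open import Data.Empty using (⊥; ⊥-elim)
open import Data.Maybe using (Maybe; just; nothing)
import Data.Maybe as Maybe
import Data.Maybe.Properties as Maybeₚ
open import Data.List using (List; []; _∷_; map; length; _++_; [_]; lookup; filter; allFin; tabulate)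
open import Data.List.Properties using (map-++; ++-identityʳ; ++-assoc; ++-cancelˡ; ∷-injective; length-++; length-map)
open import Data.List.Relation.Unary.All using ([]; _∷_)
open import Data.List.Relation.Unary.All.Properties using (¬Any⇒All¬)
open import Data.List.Relation.Unary.Any using (Any; here; there; index)
import Data.List.Relation.Unary.Any as Any
open import Data.List.Relation.Unary.Any.Properties using (lookup-index)
open import Data.List.Relation.Unary.AllPairs using ([]; _∷_)
open import Data.List.Relation.Unary.Unique.Propositional using (Unique)
import Data.List.Relation.Unary.Unique.Propositional.Properties as Uniqueₚ
open import Data.List.Membership.Propositional using (_∈_; _∉_; find; lose)
open import Data.List.Membership.Propositional.Properties
  using (∈-++⁺ˡ; ∈-++⁺ʳ; ∈-++⁻; ∈-filter⁺; ∈-filter⁻; ∈-lookup; ∈-allFin; ∈-map⁺; ∈-map⁻)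
open import Data.List.Membership.DecPropositional using () renaming (_∈?_ to ∈?[_])
import Data.Vec as Vec
import Data.Vec.Properties as Vecₚ
open import Function using (_∘_)
open import Data.Nat.Solver using (module +-*-Solver)
open +-*-Solver using (solve; _:*_; _:+_; _:=_; con)
open import Relation.Binary.PropositionalEquality hiding ([_])
open import Relation.Binary.Definitions using (DecidableEquality)
open import Relation.Nullary using (¬_; Dec; yes; no; does)
open import Relation.Nullary.Decidable using (⌊_⌋; dec-true; dec-false; _×-dec_; ¬?)

does⇒ : ∀ {A : Set} (A? : Dec A) → does A? ≡ true → A
does⇒ (yes a) _ = a

infix 8 _==_
_==_ : ∀ {n} → Fin n → Fin n → Bool
x == y = does (x ≟ y)

==-refl : ∀ {n} (x : Fin n) → (x == x) ≡ true
==-refl x = dec-true (x ≟ x) refl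

==-≢ : ∀ {n} {x y : Fin n} → x ≢ y → (x == y) ≡ false
==-≢ = dec-false (_ ≟ _)

==⇒≡ : ∀ {n} {x y : Fin n} → (x == y) ≡ true → x ≡ y
==⇒≡ = does⇒ (_ ≟ _)

∧-true : ∀ {a b} → (a ∧ b) ≡ true → a ≡ true × b ≡ true
∧-true {a} {b} h = ∧-conicalˡ a b h , ∧-conicalʳ a b h

∨-false : ∀ {a b} → (a ∨ b) ≡ false → a ≡ false × b ≡ false
∨-false {a} {b} h = ∨-conicalˡ a b h , ∨-conicalʳ a b h

∨-true : ∀ {a b} → (a ∨ b) ≡ true → a ≡ true ⊎ b ≡ true
∨-true {true} _ = inj₁ refl
∨-true {false} h = inj₂ h

not-true : ∀ {a} → not a ≡ true → a ≡ false
not-true {false} _ = refl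

if-true : ∀ {A : Set} {b} (x y : A) → b ≡ true → (if b then x else y) ≡ x
if-true x y refl = refl

if-false : ∀ {A : Set} {b} (x y : A) → b ≡ false → (if b then x else y) ≡ y
if-false x y refl = refl

false≢true : false ≢ true
false≢true ()

Bool-cases : ∀ b → b ≡ true ⊎ b ≡ false
Bool-cases true = inj₁ refl
Bool-cases false = inj₂ refl

indicator : Bool → ℕ
indicator true = 1
indicator false = 0

count : ∀ {n} → (Fin n → Bool) → ℕ
count {n} b = ∑[ x < n ] indicator (b x)

sum-mono-≤ : ∀ {n} {f g : Fin n → ℕ} → (∀ i → f i ≤ g i) → sum f ≤ sum g
sum-mono-≤ {zero} h = z≤n
sum-mono-≤ {suc n} h = +-mono-≤ (h zero) (sum-mono-≤ (h ∘ suc))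

sum-zero : ∀ {n} {f : Fin n → ℕ} → (∀ i → f i ≡ 0) → sum f ≡ 0
sum-zero {zero} h = refl
sum-zero {suc n} h rewrite h zero = sum-zero (h ∘ suc)

count-const-true : ∀ {n} → count {n} (λ _ → true) ≡ n
count-const-true {zero} = refl
count-const-true {suc n} = cong suc count-const-true

count-≡ : ∀ {n} (x : Fin n) → count (λ t → does (x ≟ t)) ≡ 1
count-≡ {suc n} zero = cong suc (sum-zero {n} (λ _ → refl))
count-≡ {suc n} (suc x) = trans (sum-cong-≗ (cong indicator ∘ shift)) (count-≡ x)
  where
  shift : ∀ t → does (suc x ≟ suc t) ≡ does (x ≟ t)
  shift t with x ≟ t
  ... | yes _ = refl
  ... | no _ = refl

count-mono : ∀ {n} {b c : Fin n → Bool} → (∀ x → b x ≡ true → c x ≡ true) → count b ≤ count c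
count-mono h = sum-mono-≤ (λ x → indicator-mono (h x))
  where
  indicator-mono : ∀ {a c} → (a ≡ true → c ≡ true) → indicator a ≤ indicator c
  indicator-mono {false} _ = z≤n
  indicator-mono {true} a⇒c rewrite a⇒c refl = ≤-refl

count-∨ : ∀ {n} (b c : Fin n → Bool) → count (λ x → b x ∨ c x) ≤ count b + count c
count-∨ b c = ≤-trans (sum-mono-≤ (λ x → indicator-∨ (b x) (c x))) (≤-reflexive (∑-distrib-+ (indicator ∘ b) (indicator ∘ c)))
  where
  indicator-∨ : ∀ a c → indicator (a ∨ c) ≤ indicator a + indicator c
  indicator-∨ false c = ≤-refl
  indicator-∨ true c = s≤s z≤n

count-split : ∀ {n} (b c : Fin n → Bool) →
  count b ≡ count (λ x → b x ∧ c x) + count (λ x → b x ∧ not (c x))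
count-split b c = trans (sum-cong-≗ (λ x → indicator-split (b x) (c x)))
  (∑-distrib-+ (λ x → indicator (b x ∧ c x)) (λ x → indicator (b x ∧ not (c x))))
  where
  indicator-split : ∀ a c → indicator a ≡ indicator (a ∧ c) + indicator (a ∧ not c)
  indicator-split false c = refl
  indicator-split true false = refl
  indicator-split true true = refl

count-≤1 : ∀ {n} (b : Fin n → Bool) → (∀ x y → b x ≡ true → b y ≡ true → x ≡ y) → count b ≤ 1
count-≤1 {zero} b h = z≤n
count-≤1 {suc n} b h with b zero in b0
... | true = ≤-reflexive (cong suc (sum-zero only-zero))
  where
  only-zero : ∀ i → indicator (b (suc i)) ≡ 0
  only-zero i with b (suc i) in bi
  ... | false = refl
  ... | true with h zero (suc i) b0 bi
  ... | ()
... | false = count-≤1 (b ∘ suc) (λ x y p q → suc-injective (h (suc x) (suc y) p q))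

count-≤3 : ∀ {n} (b : Fin n → Bool) (a₁ a₂ a₃ : Fin n) →
  (∀ x → b x ≡ true → x ≡ a₁ ⊎ x ≡ a₂ ⊎ x ≡ a₃) → count b ≤ 3
count-≤3 b a₁ a₂ a₃ h = begin
  count b                                   ≤⟨ count-mono covered ⟩
  count (λ x → eq₁ x ∨ (eq₂ x ∨ eq₃ x))     ≤⟨ count-∨ eq₁ _ ⟩
  count eq₁ + count (λ x → eq₂ x ∨ eq₃ x)   ≤⟨ +-monoʳ-≤ (count eq₁) (count-∨ eq₂ eq₃) ⟩
  count eq₁ + (count eq₂ + count eq₃)       ≡⟨ cong₂ _+_ (count-≡ a₁) (cong₂ _+_ (count-≡ a₂) (count-≡ a₃)) ⟩
  3                                         ∎
  where
  open ≤-Reasoning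
  eq₁ eq₂ eq₃ : _ → Bool
  eq₁ x = does (a₁ ≟ x)
  eq₂ x = does (a₂ ≟ x)
  eq₃ x = does (a₃ ≟ x)
  covered : ∀ x → b x ≡ true → (eq₁ x ∨ (eq₂ x ∨ eq₃ x)) ≡ true
  covered x bx with h x bx
  ... | inj₁ x≡a₁ rewrite dec-true (a₁ ≟ x) (sym x≡a₁) = refl
  ... | inj₂ (inj₁ x≡a₂) rewrite dec-true (a₂ ≟ x) (sym x≡a₂) = ∨-zeroʳ (eq₁ x)
  ... | inj₂ (inj₂ x≡a₃) rewrite dec-true (a₃ ≟ x) (sym x≡a₃) | ∨-zeroʳ (eq₂ x) = ∨-zeroʳ (eq₁ x)

count-fibres : ∀ {n m} (P : Fin n → Bool) (Q : Fin m → Bool) (g : Fin n → Fin m) (B : ℕ) →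
  (∀ x → P x ≡ true → Q (g x) ≡ true) →
  (∀ t → Q t ≡ true → count (λ x → P x ∧ does (g x ≟ t)) ≤ B) →
  count P ≤ B * count Q
count-fibres {n} {m} P Q g B P⇒Q fibre≤B = begin
  count P                                              ≡⟨ sum-cong-≗ split-by-image ⟩
  ∑[ x < n ] ∑[ t < m ] indicator (P x ∧ does (g x ≟ t)) ≡⟨ ∑-comm (λ x t → indicator (P x ∧ does (g x ≟ t))) ⟩
  ∑[ t < m ] count (λ x → P x ∧ does (g x ≟ t))          ≤⟨ sum-mono-≤ fibre≤ ⟩
  ∑[ t < m ] (B * indicator (Q t))                     ≡⟨ *-distribˡ-sum B (indicator ∘ Q) ⟨
  B * count Q                                          ∎
  where
  open ≤-Reasoning
  split-by-image : ∀ x → indicator (P x) ≡ ∑[ t < m ] indicator (P x ∧ does (g x ≟ t))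
  split-by-image x with P x
  ... | true = sym (count-≡ (g x))
  ... | false = sym (sum-zero {m} (λ _ → refl))
  fibre≤ : ∀ t → count (λ x → P x ∧ does (g x ≟ t)) ≤ B * indicator (Q t)
  fibre≤ t with Q t in Qt
  ... | true = ≤-trans (fibre≤B t Qt) (≤-reflexive (sym (*-identityʳ B)))
  ... | false = ≤-reflexive (trans (sum-zero empty) (sym (*-zeroʳ B)))
    where
    empty : ∀ x → indicator (P x ∧ does (g x ≟ t)) ≡ 0
    empty x with P x in Px | g x ≟ t
    ... | false | _ = refl
    ... | true | no _ = refl
    ... | true | yes refl with trans (sym (P⇒Q x Px)) Qt
    ... | ()

count-injection : ∀ {n m} (P : Fin n → Bool) (Q : Fin m → Bool) (g : Fin n → Fin m) →
  (∀ x → P x ≡ true → Q (g x) ≡ true) →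
  (∀ x y → P x ≡ true → P y ≡ true → g x ≡ g y → x ≡ y) →
  count P ≤ count Q
count-injection P Q g P⇒Q g-inj =
  ≤-trans (count-fibres P Q g 1 P⇒Q (λ t _ → count-≤1 _ (fibre-single t))) (≤-reflexive (*-identityˡ _))
  where
  in-fibre : ∀ t x → (P x ∧ does (g x ≟ t)) ≡ true → P x ≡ true × g x ≡ t
  in-fibre t x h with P x | g x ≟ t
  in-fibre t x () | false | _
  in-fibre t x () | true | no _
  ... | true | yes gx≡t = refl , gx≡t
  fibre-single : ∀ t x y → (P x ∧ does (g x ≟ t)) ≡ true → (P y ∧ does (g y ≟ t)) ≡ true → x ≡ y
  fibre-single t x y hx hy with in-fibre t x hx | in-fibre t y hy
  ... | Px , gx | Py , gy = g-inj x y Px Py (trans gx (sym gy))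

count≥2⇒other : ∀ {n} (b : Fin n → Bool) (u : Fin n) → 2 ≤ count b → ∃ λ y → b y ≡ true × y ≢ u
count≥2⇒other b u h with any? (λ y → Bool._≟_ (b y) true ×-dec ¬? (y ≟ u))
... | yes p = p
... | no none = ⊥-elim (<⇒≱ h (count-≤1 b only-u))
  where
  only-u : ∀ x y → b x ≡ true → b y ≡ true → x ≡ y
  only-u x y bx by with x ≟ u | y ≟ u
  ... | yes x≡u | yes y≡u = trans x≡u (sym y≡u)
  ... | no x≢u | _ = ⊥-elim (none (x , bx , x≢u))
  ... | _ | no y≢u = ⊥-elim (none (y , by , y≢u))

length-filter-tabulate : ∀ {a} {A : Set a} {n} {P : A → Set} (P? : (x : A) → Dec (P x)) (f : Fin n → A) →
  length (filter P? (tabulate f)) ≡ ∑[ i < n ] indicator (does (P? (f i)))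
length-filter-tabulate {n = zero} P? f = refl
length-filter-tabulate {n = suc n} P? f with does (P? (f zero))
... | true = cong suc (length-filter-tabulate P? (f ∘ suc))
... | false = length-filter-tabulate P? (f ∘ suc)

∣tabulate∣≡count : ∀ {n} (b : Fin n → Bool) → S.∣ Vec.tabulate b ∣ ≡ count b
∣tabulate∣≡count {zero} b = refl
∣tabulate∣≡count {suc n} b with b zero
... | true = cong suc (∣tabulate∣≡count (b ∘ suc))
... | false = ∣tabulate∣≡count (b ∘ suc)

module _ {A : Set} where

  Unique-∷⁺ : ∀ {x : A} {xs} → x ∉ xs → Unique xs → Unique (x ∷ xs)
  Unique-∷⁺ {xs = xs} x∉xs u = ¬Any⇒All¬ xs x∉xs ∷ u

  Unique-tail : ∀ {x : A} {xs} → Unique (x ∷ xs) → Unique xs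
  Unique-tail (_ ∷ u) = u

  Unique-++⁻ˡ : ∀ (xs : List A) {ys} → Unique (xs ++ ys) → Unique xs
  Unique-++⁻ˡ [] u = []
  Unique-++⁻ˡ (x ∷ xs) u =
    Unique-∷⁺ (λ m → Uniqueₚ.Unique[x∷xs]⇒x∉xs u (∈-++⁺ˡ m)) (Unique-++⁻ˡ xs (Unique-tail u))

  Unique-++⁻ʳ : ∀ (xs : List A) {ys} → Unique (xs ++ ys) → Unique ys
  Unique-++⁻ʳ [] u = u
  Unique-++⁻ʳ (x ∷ xs) u = Unique-++⁻ʳ xs (Unique-tail u)

  Unique-++-disjoint : ∀ (xs : List A) {ys} {z} → Unique (xs ++ ys) → z ∈ xs → z ∉ ys
  Unique-++-disjoint (x ∷ xs) u (here refl) m = Uniqueₚ.Unique[x∷xs]⇒x∉xs u (∈-++⁺ʳ xs m)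
  Unique-++-disjoint (x ∷ xs) u (there m₁) m₂ = Unique-++-disjoint xs (Unique-tail u) m₁ m₂

  Unique-∷ʳ⁺ : ∀ (xs : List A) {y} → Unique xs → y ∉ xs → Unique (xs ++ [ y ])
  Unique-∷ʳ⁺ [] u y∉ = [] ∷ []
  Unique-∷ʳ⁺ (x ∷ xs) u y∉ =
    Unique-∷⁺ x∉ (Unique-∷ʳ⁺ xs (Unique-tail u) (y∉ ∘ there))
    where
    x∉ : x ∉ xs ++ [ _ ]
    x∉ m with ∈-++⁻ xs m
    ... | inj₁ m′ = Uniqueₚ.Unique[x∷xs]⇒x∉xs u m′
    ... | inj₂ (here refl) = y∉ (here refl)

  lookup-injective : ∀ (xs : List A) → Unique xs → ∀ i j → lookup xs i ≡ lookup xs j → i ≡ j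
  lookup-injective (x ∷ xs) u zero zero _ = refl
  lookup-injective (x ∷ xs) u zero (suc j) e =
    ⊥-elim (Uniqueₚ.Unique[x∷xs]⇒x∉xs u (subst (_∈ xs) (sym e) (∈-lookup j)))
  lookup-injective (x ∷ xs) u (suc i) zero e =
    ⊥-elim (Uniqueₚ.Unique[x∷xs]⇒x∉xs u (subst (_∈ xs) e (∈-lookup i)))
  lookup-injective (x ∷ xs) u (suc i) (suc j) e = cong suc (lookup-injective xs (Unique-tail u) i j e)

  lookup-injective⇒Unique : ∀ (xs : List A) → (∀ i j → lookup xs i ≡ lookup xs j → i ≡ j) → Unique xs
  lookup-injective⇒Unique [] _ = []
  lookup-injective⇒Unique (x ∷ xs) inj =
    Unique-∷⁺ (λ m → 0≢1+n (inj zero (suc (index m)) (lookup-index m)))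
              (lookup-injective⇒Unique xs (λ i j e → suc-injective (inj (suc i) (suc j) e)))

Unique⇒length≤ : ∀ {n} (xs : List (Fin n)) → Unique xs → length xs ≤ n
Unique⇒length≤ xs u = injective⇒≤ (λ {i} {j} → lookup-injective xs u i j)

init-last : ∀ {A : Set} (s : List A) → s ≢ [] → ∃ λ a → ∃ λ z → s ≡ a ++ [ z ]
init-last [] s≢[] = ⊥-elim (s≢[] refl)
init-last (x ∷ []) _ = [] , x , refl
init-last (x ∷ y ∷ s) _ with init-last (y ∷ s) (λ ())
... | a , z , e = x ∷ a , z , cong (x ∷_) e

++-prefixes-comparable : ∀ {A : Set} (a b c d : List A) → a ++ b ≡ c ++ d →
  (∃ λ e → c ≡ a ++ e) ⊎ (∃ λ e → a ≡ c ++ e)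
++-prefixes-comparable [] b c d _ = inj₁ (c , refl)
++-prefixes-comparable (x ∷ a) b [] d _ = inj₂ (x ∷ a , refl)
++-prefixes-comparable (x ∷ a) b (y ∷ c) d eq with ∷-injective eq
... | refl , eq′ with ++-prefixes-comparable a b c d eq′
... | inj₁ (e , h) = inj₁ (e , cong (x ∷_) h)
... | inj₂ (e , h) = inj₂ (e , cong (x ∷_) h)

∷ʳ-length-≢ : ∀ {A : Set} (a : List A) z → a ≢ a ++ [ z ]
∷ʳ-length-≢ a z e = <-irrefl (trans (cong length e) (trans (length-++ a) (+-comm (length a) 1))) ≤-refl

module _ {A : Set} (_≟_ : DecidableEquality A) where

  stripPrefix : List A → List A → Maybe (List A)
  stripPrefix [] ys = just ys
  stripPrefix (x ∷ xs) [] = nothing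
  stripPrefix (x ∷ xs) (y ∷ ys) with x ≟ y
  ... | yes _ = stripPrefix xs ys
  ... | no _ = nothing

  stripPrefix-sound : ∀ a b s → stripPrefix a b ≡ just s → b ≡ a ++ s
  stripPrefix-sound [] b s refl = refl
  stripPrefix-sound (x ∷ a) (y ∷ b) s e with x ≟ y
  ... | yes refl = cong (x ∷_) (stripPrefix-sound a b s e)

  stripPrefix-complete : ∀ a s → stripPrefix a (a ++ s) ≡ just s
  stripPrefix-complete [] s = refl
  stripPrefix-complete (x ∷ a) s with x ≟ x
  ... | yes _ = stripPrefix-complete a s
  ... | no x≢x = ⊥-elim (x≢x refl)

  indexOf : (xs : List A) → A → Maybe (Fin (length xs))
  indexOf xs x with Any.any? (x ≟_) xs
  ... | yes p = just (index p)
  ... | no _ = nothing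

  indexOf-sound : ∀ xs x {i} → indexOf xs x ≡ just i → lookup xs i ≡ x
  indexOf-sound xs x e with Any.any? (x ≟_) xs
  ... | yes p = trans (cong (lookup xs) (sym (Maybeₚ.just-injective e))) (sym (lookup-index p))
  ... | no _ with e
  ... | ()

  indexOf-complete : ∀ xs x → x ∈ xs → ∃ λ i → indexOf xs x ≡ just i
  indexOf-complete xs x m with Any.any? (x ≟_) xs
  ... | yes p = index p , refl
  ... | no ¬p = ⊥-elim (¬p (lose m refl))

module _ {n : ℕ} where

  Step : Set
  Step = Edge n × Fin n

  _≟E_ : (e f : Edge n) → Dec (e ≡ f)
  _≟E_ = ≡-dec _≟_ (≡-dec _≟_ _≟_)

  _≟Step_ : DecidableEquality Step
  _≟Step_ = ≡-dec _≟E_ _≟_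

  pathVertices : Fin n → List Step → List (Fin n)
  pathVertices x s = x ∷ map proj₂ s

  pathEdges : List Step → List (Edge n)
  pathEdges s = map proj₁ s

  lastV-++ : ∀ x (a b : List Step) → lastV x (a ++ b) ≡ lastV (lastV x a) b
  lastV-++ x [] b = refl
  lastV-++ x ((e , y) ∷ a) b = lastV-++ y a b

  pathVertices-++ : ∀ x (a b : List Step) → pathVertices x (a ++ b) ≡ pathVertices x a ++ map proj₂ b
  pathVertices-++ x a b = cong (x ∷_) (map-++ proj₂ a b)

  lastV∈ : ∀ x (s : List Step) → lastV x s ∈ pathVertices x s
  lastV∈ x [] = here refl
  lastV∈ x ((e , y) ∷ s) = there (lastV∈ y s)

  split-at-vertex : ∀ x (s : List Step) v → v ∈ pathVertices x s →
    ∃ λ a → ∃ λ b → s ≡ a ++ b × lastV x a ≡ v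
  split-at-vertex x s v (here refl) = [] , s , refl , refl
  split-at-vertex x ((e , y) ∷ s) v (there m) with split-at-vertex y s v m
  ... | a , b , eq , l = (e , y) ∷ a , b , cong ((e , y) ∷_) eq , l

  split-at-edge : ∀ (s : List Step) f → f ∈ pathEdges s → ∃ λ a → ∃ λ z → ∃ λ b → s ≡ a ++ (f , z) ∷ b
  split-at-edge ((e , y) ∷ s) f (here refl) = [] , y , s , refl
  split-at-edge ((e , y) ∷ s) f (there m) with split-at-edge s f m
  ... | a , z , b , eq = (e , y) ∷ a , z , b , cong ((e , y) ∷_) eq

  _∈V?_ : (v : Fin n) (xs : List (Fin n)) → Dec (v ∈ xs)
  _∈V?_ = ∈?[ _≟_ ]

  _∈E?_ : (f : Edge n) (xs : List (Edge n)) → Dec (f ∈ xs)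
  _∈E?_ = ∈?[ _≟E_ ]

  lastV∈tail : ∀ x (b : List Step) → b ≢ [] → lastV x b ∈ map proj₂ b
  lastV∈tail x [] b≢[] = ⊥-elim (b≢[] refl)
  lastV∈tail x ((e , y) ∷ b) _ = lastV∈ y b

  pathEdges-++⁺ˡ : ∀ (a b : List Step) {f} → f ∈ pathEdges a → f ∈ pathEdges (a ++ b)
  pathEdges-++⁺ˡ a b {f} m = subst (f ∈_) (sym (map-++ proj₁ a b)) (∈-++⁺ˡ m)

  reverseSteps : Fin n → List Step → List Step
  reverseSteps x [] = []
  reverseSteps x ((e , y) ∷ s) = reverseSteps y s ++ [ (e , x) ]

  module _ (H : Edge n → Set) where

    ValidSteps-++⁻ : ∀ x (a b : List Step) → ValidSteps H x (a ++ b) →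
      ValidSteps H x a × ValidSteps H (lastV x a) b
    ValidSteps-++⁻ x [] b v = tt , v
    ValidSteps-++⁻ x ((e , y) ∷ a) b (h , p , q , v) with ValidSteps-++⁻ y a b v
    ... | va , vb = (h , p , q , va) , vb

    ValidSteps-++⁺ : ∀ x (a b : List Step) → ValidSteps H x a → ValidSteps H (lastV x a) b →
      ValidSteps H x (a ++ b)
    ValidSteps-++⁺ x [] b _ vb = vb
    ValidSteps-++⁺ x ((e , y) ∷ a) b (h , p , q , va) vb = h , p , q , ValidSteps-++⁺ y a b va vb

    ValidSteps-map : ∀ {H′ : Edge n → Set} → (∀ {e} → H e → H′ e) → ∀ x s → ValidSteps H x s → ValidSteps H′ x s
    ValidSteps-map h x [] _ = tt
    ValidSteps-map h x ((e , y) ∷ s) (he , xe , ye , v) = h he , xe , ye , ValidSteps-map h y s v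

    ValidSteps-reverse : ∀ x (s : List Step) → ValidSteps H x s →
      ValidSteps H (lastV x s) (reverseSteps x s) × lastV (lastV x s) (reverseSteps x s) ≡ x
    ValidSteps-reverse x [] _ = tt , refl
    ValidSteps-reverse x ((e , y) ∷ s) (h , xe , ye , v) with ValidSteps-reverse y s v
    ... | v′ , l′ =
      ValidSteps-++⁺ (lastV y s) (reverseSteps y s) _ v′ (h , subst (_∈ₑ e) (sym l′) ye , xe , tt) ,
      lastV-++ (lastV y s) (reverseSteps y s) _

    IsPath-prefix : ∀ x y (a b : List Step) → IsPath H x y (a ++ b) → IsPath H x (lastV x a) a
    IsPath-prefix x y a b (v , _ , u₁ , u₂) =
      proj₁ (ValidSteps-++⁻ x a b v) , refl ,
      Unique-++⁻ˡ (pathVertices x a) (subst Unique (pathVertices-++ x a b) u₁) ,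
      Unique-++⁻ˡ (pathEdges a) (subst Unique (map-++ proj₁ a b) u₂)

    IsPath-suffix : ∀ x y (a b : List Step) → IsPath H x y (a ++ b) → IsPath H (lastV x a) y b
    IsPath-suffix x y a b (v , l , u₁ , u₂) =
      proj₂ (ValidSteps-++⁻ x a b v) , trans (sym (lastV-++ x a b)) l ,
      drop-vertices a u₁ ,
      Unique-++⁻ʳ (pathEdges a) (subst Unique (map-++ proj₁ a b) u₂)
      where
      drop-vertices : ∀ {x} (a : List Step) → Unique (pathVertices x (a ++ b)) → Unique (pathVertices (lastV x a) b)
      drop-vertices [] u = u
      drop-vertices ((e , y) ∷ a) u = drop-vertices a (Unique-tail u)

    IsPath-∷ʳ : ∀ x z (s : List Step) f y → IsPath H x z s → H f → z ∈ₑ f → y ∈ₑ f →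
      y ∉ pathVertices x s → f ∉ pathEdges s → IsPath H x y (s ++ [ (f , y) ])
    IsPath-∷ʳ x z s f y (v , l , u₁ , u₂) hf zf yf y∉ f∉ =
      ValidSteps-++⁺ x s _ v (hf , subst (_∈ₑ f) (sym l) zf , yf , tt) ,
      lastV-++ x s _ ,
      subst Unique (sym (pathVertices-++ x s [ (f , y) ])) (Unique-∷ʳ⁺ (pathVertices x s) u₁ y∉) ,
      subst Unique (sym (map-++ proj₁ s _)) (Unique-∷ʳ⁺ (pathEdges s) u₂ f∉)

    -- Shortcut the walk at the first repeated vertex or edge.
    walk⇒path : ∀ x (s : List Step) → ValidSteps H x s → ∃ λ t → IsPath H x (lastV x s) t
    walk⇒path x [] _ = [] , tt , refl , ([] ∷ []) , []
    walk⇒path x ((e , y) ∷ s) (h , xe , ye , v) with walk⇒path y s v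
    ... | t , P@(v′ , l′ , u₁ , u₂) with ∈?[ _≟_ ] x (pathVertices y t)
    ... | yes m with split-at-vertex y t x m
    ... | a , b , refl , la = b , subst (λ z → IsPath H z (lastV y s) b) la (IsPath-suffix y _ a b P)
    walk⇒path x ((e , y) ∷ s) (h , xe , ye , v) | t , P | no x∉ with ∈?[ _≟E_ ] e (pathEdges t)
    ... | yes me with split-at-edge t e me
    ... | a , w , b , refl with IsPath-suffix y _ a ((e , w) ∷ b) P
    ... | (_ , _ , we , vb) , lb , ub₁ , ub₂ =
      (e , w) ∷ b , (h , xe , we , vb) , lb ,
      Unique-∷⁺ (λ m → x∉ (subst (x ∈_) (sym (pathVertices-++ y a ((e , w) ∷ b))) (∈-++⁺ʳ (pathVertices y a) m)))
                (Unique-tail ub₁) ,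
      ub₂
    walk⇒path x ((e , y) ∷ s) (h , xe , ye , v) | t , (v′ , l′ , u₁ , u₂) | no x∉ | no e∉ =
      (e , y) ∷ t , (h , xe , ye , v′) , l′ , Unique-∷⁺ x∉ u₁ , Unique-∷⁺ e∉ u₂

two-members⇒length≥2 : ∀ {A : Set} {a b : A} {xs} → a ∈ xs → b ∈ xs → a ≢ b → 2 ≤ length xs
two-members⇒length≥2 (here refl) (here refl) ne = ⊥-elim (ne refl)
two-members⇒length≥2 {xs = _ ∷ y ∷ ys} (here refl) (there mb) ne = s≤s (s≤s z≤n)
two-members⇒length≥2 {xs = _ ∷ y ∷ ys} (there ma) (here refl) ne = s≤s (s≤s z≤n)
two-members⇒length≥2 (there ma) (there mb) ne = ≤-trans (two-members⇒length≥2 ma mb ne) (n≤1+n _)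

otherTwo : ∀ {n} → Fin n → Edge n → Fin n × Fin n
otherTwo u (a , b , c) with u ≟ a
... | yes _ = b , c
... | no _ with u ≟ b
... | yes _ = a , c
... | no _ = a , b

record OtherTwo {n} (u : Fin n) (f : Edge n) (p q : Fin n) : Set where
  field
    pf : p ∈ₑ f
    qf : q ∈ₑ f
    p≢q : p ≢ q
    p≢u : p ≢ u
    q≢u : q ≢ u
    all : ∀ x → x ∈ₑ f → x ≡ u ⊎ x ≡ p ⊎ x ≡ q

otherTwo-spec : ∀ {n} (u : Fin n) f → Is3Edge f → u ∈ₑ f → OtherTwo u f (proj₁ (otherTwo u f)) (proj₂ (otherTwo u f))
otherTwo-spec u (a , b , c) (ab , ac , bc) m with u ≟ a
... | yes refl = record { pf = inj₂ (inj₁ refl) ; qf = inj₂ (inj₂ refl) ; p≢q = bc ; p≢u = λ e → ab (sym e) ; q≢u = λ e → ac (sym e)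
                        ; all = λ x m → m }
... | no ua with u ≟ b
... | yes refl = record { pf = inj₁ refl ; qf = inj₂ (inj₂ refl) ; p≢q = ac ; p≢u = ab ; q≢u = λ e → bc (sym e)
                        ; all = λ { x (inj₁ e) → inj₂ (inj₁ e) ; x (inj₂ (inj₁ e)) → inj₁ e ; x (inj₂ (inj₂ e)) → inj₂ (inj₂ e) } }
... | no ub = record { pf = inj₁ refl ; qf = inj₂ (inj₁ refl) ; p≢q = ab ; p≢u = λ e → ua (sym e) ; q≢u = λ e → ub (sym e)
                     ; all = λ { x (inj₁ e) → inj₂ (inj₁ e) ; x (inj₂ (inj₁ e)) → inj₂ (inj₂ e) ; x (inj₂ (inj₂ e)) → inj₁ (cu e) } }
  where
  cu' : ∀ {x} → x ≡ c → u ≡ a ⊎ u ≡ b ⊎ u ≡ c → x ≡ u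
  cu' e (inj₁ e') = ⊥-elim (ua e')
  cu' e (inj₂ (inj₁ e')) = ⊥-elim (ub e')
  cu' e (inj₂ (inj₂ e')) = trans e (sym e')
  cu : ∀ {x} → x ≡ c → x ≡ u
  cu e = cu' e m

≈ₑ-otherTwo : ∀ {n} {u p q : Fin n} {f} → OtherTwo u f p q → u ∈ₑ f → f ≈ₑ (p , q , u)
≈ₑ-otherTwo {u = u} {p} {q} {f} s um v = to , from
  where
  to : v ∈ₑ f → v ∈ₑ (p , q , u)
  to m with OtherTwo.all s v m
  ... | inj₁ e = inj₂ (inj₂ e)
  ... | inj₂ (inj₁ e) = inj₁ e
  ... | inj₂ (inj₂ e) = inj₂ (inj₁ e)
  from : v ∈ₑ (p , q , u) → v ∈ₑ f
  from (inj₁ refl) = OtherTwo.pf s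
  from (inj₂ (inj₁ refl)) = OtherTwo.qf s
  from (inj₂ (inj₂ refl)) = um

≈ₑ-swap : ∀ {n} {p q u : Fin n} {f} → f ≈ₑ (p , q , u) → f ≈ₑ (q , p , u)
≈ₑ-swap e v = (λ m → sw (proj₁ (e v) m)) , (λ m → proj₂ (e v) (sw m))
  where
  sw : ∀ {v p q u : Fin _} → v ∈ₑ (p , q , u) → v ∈ₑ (q , p , u)
  sw (inj₁ x) = inj₂ (inj₁ x)
  sw (inj₂ (inj₁ x)) = inj₁ x
  sw (inj₂ (inj₂ x)) = inj₂ (inj₂ x)

record ThirdVertex {n} (u t o : Fin n) (f : Edge n) : Set where
  field
    ∈f : o ∈ₑ f
    ≢u : o ≢ u
    all : ∀ z → z ∈ₑ f → z ≡ u ⊎ z ≡ t ⊎ z ≡ o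

thirdOf : ∀ {n} → Fin n → Fin n → Fin n → Fin n
thirdOf t p q = if does (t ≟ p) then q else p

thirdOf-spec : ∀ {n} (u t p q : Fin n) f → OtherTwo u f p q → t ∈ₑ f → t ≢ u → ThirdVertex u t (thirdOf t p q) f
thirdOf-spec u t p q f os tf tu with t ≟ p
... | yes refl = record { ∈f = OtherTwo.qf os ; ≢u = OtherTwo.q≢u os
                        ; all = OtherTwo.all os }
... | no tp = record { ∈f = OtherTwo.pf os ; ≢u = OtherTwo.p≢u os
                     ; all = λ z zf → al z (OtherTwo.all os z zf) }
  where
  tq : t ≡ q
  tq with OtherTwo.all os t tf
  ... | inj₁ e = ⊥-elim (tu e)
  ... | inj₂ (inj₁ e) = ⊥-elim (tp e)
  ... | inj₂ (inj₂ e) = e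
  al : ∀ z → z ≡ u ⊎ z ≡ p ⊎ z ≡ q → z ≡ u ⊎ z ≡ t ⊎ z ≡ p
  al z (inj₁ e) = inj₁ e
  al z (inj₂ (inj₁ e)) = inj₂ (inj₂ e)
  al z (inj₂ (inj₂ e)) = inj₂ (inj₁ (trans e (sym tq)))

thirdOf-involutive : ∀ {n} (u t p q : Fin n) f → OtherTwo u f p q → t ∈ₑ f → t ≢ u → thirdOf (thirdOf t p q) p q ≡ t
thirdOf-involutive u t p q f os tf tu with t ≟ p
... | yes refl with q ≟ t
... | yes e = ⊥-elim (OtherTwo.p≢q os (sym e))
... | no _ = refl
thirdOf-involutive u t p q f os tf tu | no tp with p ≟ p
... | no ne = ⊥-elim (ne refl)
... | yes _ with OtherTwo.all os t tf
... | inj₁ e = ⊥-elim (tu e)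
... | inj₂ (inj₁ e) = ⊥-elim (tp e)
... | inj₂ (inj₂ e) = sym e

module HypertreeFacts {n : ℕ} (T : Hypergraph3 n) (HT : IsHypertree T) where

  InT : Edge n → Set
  InT e = e ∈ edges T

  connected : ∀ x y → ∃ λ s → IsPath InT x y s
  connected x y = proj₁ (proj₂ (proj₂ HT)) x y tt tt

  paths-unique : ∀ x y s t → IsPath InT x y s → IsPath InT x y t → s ≡ t
  paths-unique = proj₂ (proj₂ (proj₂ HT))

  edge-is3 : ∀ f → f ∈ edges T → Is3Edge f
  edge-is3 f m = subst Is3Edge (sym (lookup-index m)) (proj₁ (proj₁ HT) (index m))

  edges-Unique : Unique (edges T)
  edges-Unique = lookup-injective⇒Unique (edges T)
    (λ i j e → proj₂ (proj₁ HT) i j (subst (lookup (edges T) i ≈ₑ_) e (λ v → (λ x → x) , (λ x → x))))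

  edgesAt : Fin n → List (Edge n)
  edgesAt u = filter (u ∈ₑ?_) (edges T)

  two-edges⇒deg≥2 : ∀ x f g → f ∈ edges T → g ∈ edges T → x ∈ₑ f → x ∈ₑ g → f ≢ g → 2 ≤ deg T x
  two-edges⇒deg≥2 x f g mf mg xf xg f≢g =
    two-members⇒length≥2 (∈-filter⁺ (x ∈ₑ?_) mf xf) (∈-filter⁺ (x ∈ₑ?_) mg xg) f≢g

  -- Both edges give a one-step path from u to x, and paths are unique.
  two-common-vertices⇒≡ : ∀ f g u x → f ∈ edges T → g ∈ edges T → u ≢ x →
    u ∈ₑ f → x ∈ₑ f → u ∈ₑ g → x ∈ₑ g → f ≡ g
  two-common-vertices⇒≡ f g u x fT gT u≢x uf xf ug xg =
    proj₁ (∷-injective (cong (map proj₁) (paths-unique u x _ _ (one-step f fT uf xf) (one-step g gT ug xg))))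
    where
    one-step : ∀ h → h ∈ edges T → u ∈ₑ h → x ∈ₑ h → IsPath InT u x [ (h , x) ]
    one-step h hT uh xh =
      (hT , uh , xh , tt) , refl , Unique-∷⁺ (λ { (here e) → u≢x e }) (Unique-∷⁺ (λ ()) []) , Unique-∷⁺ (λ ()) []

module Rooted {n : ℕ} (T : Hypergraph3 n) (HT : IsHypertree T) (r : Fin n) where
  open HypertreeFacts T HT public

  path : Fin n → List (Step {n})
  path y = proj₁ (connected r y)

  path-IsPath : ∀ y → IsPath InT r y (path y)
  path-IsPath y = proj₂ (connected r y)

  path-unique : ∀ y s → IsPath InT r y s → s ≡ path y
  path-unique y s p = paths-unique r y s (path y) p (path-IsPath y)

  path-root : path r ≡ []
  path-root = sym (path-unique r [] (tt , refl , Unique-∷⁺ (λ ()) [] , []))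

  path-ends : ∀ y → lastV r (path y) ≡ y
  path-ends y = proj₁ (proj₂ (path-IsPath y))

  path-prefix : ∀ y a b → path y ≡ a ++ b → path (lastV r a) ≡ a
  path-prefix y a b e = sym (path-unique _ a (IsPath-prefix InT r y a b (subst (IsPath InT r y) e (path-IsPath y))))

  path-vertices-Unique : ∀ y → Unique (pathVertices r (path y))
  path-vertices-Unique y = proj₁ (proj₂ (proj₂ (path-IsPath y)))

  path-edges-Unique : ∀ y → Unique (pathEdges (path y))
  path-edges-Unique y = proj₂ (proj₂ (proj₂ (path-IsPath y)))

  lastV-of-path : ∀ y q s → path y ≡ q ++ s → lastV (lastV r q) s ≡ y
  lastV-of-path y q s e = trans (sym (lastV-++ r q s)) (trans (cong (lastV r) (sym e)) (path-ends y))

  path-step : ∀ y q g z s → path y ≡ q ++ (g , z) ∷ s → g ∈ edges T × lastV r q ∈ₑ g × z ∈ₑ g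
  path-step y q g z s e with proj₂ (ValidSteps-++⁻ InT r q _ (subst (ValidSteps InT r) e (proj₁ (path-IsPath y))))
  ... | h , a , b , _ = h , a , b

  path-edge-fresh : ∀ y q g z s → path y ≡ q ++ (g , z) ∷ s → g ∉ pathEdges q
  path-edge-fresh y q g z s e m =
    Unique-++-disjoint (pathEdges q) (subst Unique (map-++ proj₁ q _) (subst (λ w → Unique (pathEdges w)) e (path-edges-Unique y))) m (here refl)

  path-last-step : ∀ x → x ≢ r → ∃ λ a → ∃ λ f → path x ≡ a ++ [ (f , x) ]
  path-last-step x ne with init-last (path x) (λ e → ne (trans (sym (path-ends x)) (cong (lastV r) e)))
  ... | a , (f , z) , e = a , f , trans e (cong (λ w → a ++ [ (f , w) ]) zx)
    where
    zx : z ≡ x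
    zx = trans (sym (trans (lastV-++ r a _) refl)) (trans (cong (lastV r) (sym e)) (path-ends x))

  path-last-edge : ∀ x a f → path x ≡ a ++ [ (f , x) ] → f ∈ edges T × x ∈ₑ f × f ∈ pathEdges (path x)
  path-last-edge x a f e with path-step x a f x [] e
  ... | h , _ , xf = h , xf , subst (λ w → f ∈ pathEdges w) (sym e) (∈-map⁺ proj₁ (∈-++⁺ʳ a (here refl)))

  ancestor-deg≥2 : ∀ x y s → x ≢ r → path y ≡ path x ++ s → s ≢ [] → 2 ≤ deg T x
  ancestor-deg≥2 x y [] ne e sne = ⊥-elim (sne refl)
  ancestor-deg≥2 x y ((g , z) ∷ s) ne e sne with path-step y (path x) g z s e | path-last-step x ne
  ... | gT , xg , _ | a , f , ex with path-last-edge x a f ex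
  ... | fT , xf , fin =
    two-edges⇒deg≥2 x f g fT gT xf (subst (_∈ₑ g) (path-ends x) xg) (λ fg → path-edge-fresh y (path x) g z s e (subst (_∈ pathEdges (path x)) fg fin))

  depth : Fin n → ℕ
  depth y = length (path y)

  depth<n : ∀ y → depth y < n
  depth<n y = subst (λ m → suc m ≤ n) (length-map proj₂ (path y)) (Unique⇒length≤ (pathVertices r (path y)) (path-vertices-Unique y))

  lastV∉prefix : ∀ x (a b : List (Step {n})) → Unique (pathVertices x (a ++ b)) → b ≢ [] →
                   lastV x (a ++ b) ∉ pathVertices x a
  lastV∉prefix x a b u ne m =
    Unique-++-disjoint (pathVertices x a) (subst Unique (pathVertices-++ x a b) u) m
      (subst (_∈ map proj₂ b) (sym (lastV-++ x a b)) (lastV∈tail (lastV x a) b ne))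

  path-across-edge : ∀ f z0 → f ∈ edges T → z0 ∈ₑ f → f ∉ pathEdges (path z0) →
        ∀ v → v ∈ₑ f → v ≢ z0 → path v ≡ path z0 ++ [ (f , v) ]
  path-across-edge f z0 fT z0f nf v vf ne with v ∈V? pathVertices r (path z0)
  ... | no nv = sym (path-unique v _ (IsPath-∷ʳ InT r z0 (path z0) f v (path-IsPath z0) fT z0f vf nv nf))
  ... | yes m with split-at-vertex r (path z0) v m
  ... | a , b , eq , la = ⊥-elim (nf (subst (λ s → f ∈ pathEdges s) (sym e2) (subst (f ∈_) (sym (map-++ proj₁ a _)) (∈-++⁺ʳ (pathEdges a) (here refl)))))
    where
    bne : b ≢ []
    bne refl = ne (trans (sym la) (trans (cong (lastV r) (sym (++-identityʳ a))) (trans (cong (lastV r) (sym eq)) (path-ends z0))))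
    pa : IsPath InT r v a
    pa = subst (λ w → IsPath InT r w a) la (IsPath-prefix InT r z0 a b (subst (IsPath InT r z0) eq (path-IsPath z0)))
    nz0 : z0 ∉ pathVertices r a
    nz0 mm = lastV∉prefix r a b (subst (λ s → Unique (pathVertices r s)) eq (path-vertices-Unique z0)) bne
               (subst (_∈ pathVertices r a) (sym (trans (cong (lastV r) (sym eq)) (path-ends z0))) mm)
    nfa : f ∉ pathEdges a
    nfa mm = nf (subst (λ s → f ∈ pathEdges s) (sym eq) (pathEdges-++⁺ˡ a b mm))
    e2 : path z0 ≡ a ++ [ (f , z0) ]
    e2 = sym (path-unique z0 _ (IsPath-∷ʳ InT r v a f z0 pa fT vf z0f nz0 nfa))

  path-sibling : ∀ f z0 z → path z ≡ path z0 ++ [ (f , z) ] → ∀ v → v ∈ₑ f → v ≢ z0 → path v ≡ path z0 ++ [ (f , v) ]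
  path-sibling f z0 z e v vf ne = path-across-edge f z0 fT z0f nf v vf ne
    where
    vz : ValidSteps InT r (path z0 ++ [ (f , z) ])
    vz = subst (ValidSteps InT r) e (proj₁ (path-IsPath z))
    st : ValidSteps InT (lastV r (path z0)) [ (f , z) ]
    st = proj₂ (ValidSteps-++⁻ InT r (path z0) _ vz)
    fT : f ∈ edges T
    fT = proj₁ st
    z0f : z0 ∈ₑ f
    z0f = subst (_∈ₑ f) (path-ends z0) (proj₁ (proj₂ st))
    nf : f ∉ pathEdges (path z0)
    nf mm = Unique-++-disjoint (pathEdges (path z0)) (subst Unique (map-++ proj₁ (path z0) _) (subst (λ s → Unique (pathEdges s)) e (path-edges-Unique z))) mm (here refl)

  edge-top : ∀ f → f ∈ edges T → ∃ λ a → a ∈ₑ f × f ∉ pathEdges (path a)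
  edge-top f@(x0 , x1 , x2) fT with f ∈E? pathEdges (path x0)
  ... | no nf = x0 , inj₁ refl , nf
  ... | yes m with split-at-edge (path x0) f m
  ... | a , z , b , eq = lastV r a , z0f , subst (λ s → f ∉ pathEdges s) (sym pa) nfa
    where
    pa : path (lastV r a) ≡ a
    pa = path-prefix x0 a _ eq
    vz : ValidSteps InT r (a ++ (f , z) ∷ b)
    vz = subst (ValidSteps InT r) eq (proj₁ (path-IsPath x0))
    z0f : lastV r a ∈ₑ f
    z0f = proj₁ (proj₂ (proj₂ (ValidSteps-++⁻ InT r a _ vz)))
    nfa : f ∉ pathEdges a
    nfa mm = Unique-++-disjoint (pathEdges a) (subst Unique (map-++ proj₁ a _) (subst (λ s → Unique (pathEdges s)) eq (path-edges-Unique x0))) mm (here refl)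

-- The greedy choice of centres

module Greedy {n : ℕ} (T : Hypergraph3 n) (HT : IsHypertree T) (r : Fin n) (K : ℕ) where
  open Rooted T HT r public

  blocked : (Fin n → Bool) → Fin n → Edge n → Bool
  blocked c z (a , b , d) = (not (a == z) ∧ c a) ∨ ((not (b == z) ∧ c b) ∨ (not (d == z) ∧ c d))

  unblocked : (Fin n → Bool) → Fin n → List (Step {n}) → Bool
  unblocked c x [] = true
  unblocked c x ((f , z) ∷ s) = not (blocked c x f) ∧ unblocked c z s

  -- y is in the region of t when the root path of y runs through t and then
  -- only through edges containing no centre besides the vertex they are entered from.
  inRegion : (Fin n → Bool) → Fin n → Fin n → Bool
  inRegion c t y = Maybe.maybe (unblocked c t) false (stripPrefix _≟Step_ (path t) (path y))

  inRegion-sound : ∀ c t y → inRegion c t y ≡ true → ∃ λ s → path y ≡ path t ++ s × unblocked c t s ≡ true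
  inRegion-sound c t y e with stripPrefix _≟Step_ (path t) (path y) in eq
  ... | just s = s , stripPrefix-sound _≟Step_ (path t) (path y) s eq , e

  inRegion-complete : ∀ c t y s → path y ≡ path t ++ s → unblocked c t s ≡ true → inRegion c t y ≡ true
  inRegion-complete c t y s e a rewrite e | stripPrefix-complete _≟Step_ (path t) s = a

  regionSize : (Fin n → Bool) → Fin n → ℕ
  regionSize c t = count (inRegion c t)

  centresAfter : ℕ → Fin n → Bool
  centresAfter zero x = false
  centresAfter (suc m) x = x == r ∨ (K <ᵇ regionSize (centresAfter m) x)

  blocked-cong : ∀ c c′ z f → (∀ v → v ∈ₑ f → v ≢ z → c v ≡ c′ v) → blocked c z f ≡ blocked c′ z f
  blocked-cong c c′ z (a , b , d) h =
    cong₂ _∨_ (agree a (inj₁ refl)) (cong₂ _∨_ (agree b (inj₂ (inj₁ refl))) (agree d (inj₂ (inj₂ refl))))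
    where
    agree : ∀ v → v ∈ₑ (a , b , d) → (not (v == z) ∧ c v) ≡ (not (v == z) ∧ c′ v)
    agree v m with v ≟ z
    ... | yes _ = refl
    ... | no v≢z = cong (true ∧_) (h v m v≢z)

  unblocked-cong-below : ∀ c c′ x y (q s : List (Step {n})) → path y ≡ q ++ s → depth x ≤ length q →
    (∀ v → depth x < depth v → c v ≡ c′ v) → unblocked c (lastV r q) s ≡ unblocked c′ (lastV r q) s
  unblocked-cong-below c c′ x y q [] e le h = refl
  unblocked-cong-below c c′ x y q ((f , z) ∷ s) e le h =
    cong₂ _∧_ (cong not (blocked-cong c c′ z0 f agree)) (subst (λ w → unblocked c w s ≡ unblocked c′ w s) lz rec)
    where
    z0 = lastV r q
    e′ : path y ≡ (q ++ [ (f , z) ]) ++ s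
    e′ = trans e (sym (++-assoc q [ (f , z) ] s))
    pz0 : path z0 ≡ q
    pz0 = path-prefix y q _ e
    pz : path z ≡ path z0 ++ [ (f , z) ]
    pz = trans (trans (cong path (sym (lastV-++ r q [ (f , z) ]))) (path-prefix y (q ++ [ (f , z) ]) s e′))
               (cong (_++ [ (f , z) ]) (sym pz0))
    agree : ∀ v → v ∈ₑ f → v ≢ z0 → c v ≡ c′ v
    agree v vf v≢z0 = h v (subst (depth x <_) (sym depth-v) (subst (depth x <_) (+-comm 1 (length q)) (s≤s le)))
      where
      depth-v : depth v ≡ length q + 1
      depth-v = trans (cong length (path-sibling f z0 z pz v vf v≢z0))
                      (trans (length-++ (path z0)) (cong (_+ 1) (cong length pz0)))
    lz : lastV r (q ++ [ (f , z) ]) ≡ z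
    lz = lastV-++ r q [ (f , z) ]
    rec : unblocked c (lastV r (q ++ [ (f , z) ])) s ≡ unblocked c′ (lastV r (q ++ [ (f , z) ])) s
    rec = unblocked-cong-below c c′ x y (q ++ [ (f , z) ]) s e′
            (≤-trans le (subst (length q ≤_) (sym (length-++ q)) (m≤m+n _ _))) h

  regionSize-cong-below : ∀ c c′ x → (∀ v → depth x < depth v → c v ≡ c′ v) → regionSize c x ≡ regionSize c′ x
  regionSize-cong-below c c′ x h = sum-cong-≗ (λ y → cong indicator (same y))
    where
    same : ∀ y → inRegion c x y ≡ inRegion c′ x y
    same y with stripPrefix _≟Step_ (path x) (path y) in eq
    ... | nothing = refl
    ... | just s = subst (λ w → unblocked c w s ≡ unblocked c′ w s) (path-ends x)
                     (unblocked-cong-below c c′ x y (path x) s (stripPrefix-sound _≟Step_ (path x) (path y) s eq) ≤-refl h)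

  centresAfter-stable : ∀ m m′ x → n ≤ m + depth x → n ≤ m′ + depth x → centresAfter m x ≡ centresAfter m′ x
  centresAfter-stable zero m′ x h h′ = ⊥-elim (<⇒≱ (depth<n x) h)
  centresAfter-stable (suc m) zero x h h′ = ⊥-elim (<⇒≱ (depth<n x) h′)
  centresAfter-stable (suc m) (suc m′) x h h′ =
    cong (λ s → x == r ∨ (K <ᵇ s))
      (regionSize-cong-below (centresAfter m) (centresAfter m′) x (λ v lt → centresAfter-stable m m′ v (deeper m h lt) (deeper m′ h′ lt)))
    where
    deeper : ∀ k → n ≤ suc k + depth x → ∀ {v} → depth x < depth v → n ≤ k + depth v
    deeper k hk {v} lt = ≤-trans hk (subst (_≤ k + depth v) (+-suc k (depth x)) (+-monoʳ-≤ k lt))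

  -- Whether x is a centre depends only on the centres strictly below x, and depths are below n,
  -- so the iteration is stable after n steps: this is the fixed point.
  abstract
    centre : Fin n → Bool
    centre = centresAfter (suc n)

    centre-unfold : ∀ x → centre x ≡ (x == r ∨ (K <ᵇ regionSize centre x))
    centre-unfold x = cong (λ s → x == r ∨ (K <ᵇ s))
      (regionSize-cong-below (centresAfter n) centre x
        (λ v _ → centresAfter-stable n (suc n) v (m≤m+n n _) (≤-trans (n≤1+n n) (m≤m+n (suc n) _))))

cond2-arithmetic : ∀ {K d n i e c} → 2 ≤ d → K ≤ n → i ≤ suc d * e → e ≤ c + 1 → suc K * c ≤ n →
  K * i ≤ 2 * (d * d) * n
cond2-arithmetic {K} {d} {n} {i} {e} {c} 2≤d K≤n i≤ e≤ c≤ = begin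
  K * i                  ≤⟨ *-monoʳ-≤ K i≤ ⟩
  K * (suc d * e)        ≡⟨ solve 3 (λ K d e → K :* (d :* e) := d :* (K :* e)) refl K (suc d) e ⟩
  suc d * (K * e)        ≤⟨ *-monoʳ-≤ (suc d) (*-monoʳ-≤ K e≤) ⟩
  suc d * (K * (c + 1))  ≡⟨ cong (suc d *_) (solve 2 (λ K c → K :* (c :+ con 1) := K :* c :+ K) refl K c) ⟩
  suc d * (K * c + K)    ≤⟨ *-monoʳ-≤ (suc d) (+-mono-≤ (≤-trans (m≤n+m (K * c) c) c≤) K≤n) ⟩
  suc d * (n + n)        ≤⟨ *-monoˡ-≤ (n + n) d+1≤d*d ⟩
  d * d * (n + n)        ≡⟨ solve 2 (λ d n → d :* d :* (n :+ n) := con 2 :* (d :* d) :* n) refl d n ⟩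
  2 * (d * d) * n        ∎
  where
  open ≤-Reasoning
  d+1≤d*d : suc d ≤ d * d
  d+1≤d*d = begin
    suc d     ≤⟨ +-monoˡ-≤ d (≤-trans (s≤s z≤n) 2≤d) ⟩
    d + d     ≡⟨ cong (d +_) (sym (+-identityʳ d)) ⟩
    2 * d     ≤⟨ *-monoˡ-≤ d 2≤d ⟩
    d * d     ∎

module Construction {n : ℕ} (T : Hypergraph3 n) (HT : IsHypertree T)
  (has-leaf : ∀ f → f ∈ edges T → ∃ λ v → v ∈ₑ f × deg T v ≡ 1)
  (r : Fin n) (deg-r≥2 : 2 ≤ deg T r) (K : ℕ) (K≥1 : 1 ≤ K) where
  open Greedy T HT r K public

  centre-root : centre r ≡ true
  centre-root rewrite centre-unfold r | ==-refl r = refl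

  centre⇒large-region : ∀ x → centre x ≡ true → x ≢ r → K < regionSize centre x
  centre⇒large-region x cx ne with trans (sym (centre-unfold x)) cx
  ... | e rewrite ==-≢ ne = <ᵇ⇒< K (regionSize centre x) (subst Bool.T (sym e) tt)

  ¬centre⇒small-region : ∀ x → centre x ≡ false → regionSize centre x ≤ K
  ¬centre⇒small-region x cx with _≤?_ (regionSize centre x) K
  ... | yes p = p
  ... | no np = ⊥-elim (subst Bool.T (proj₂ (∨-false (trans (sym (centre-unfold x)) cx))) (<⇒<ᵇ (≰⇒> np)))

  leaf≢root : ∀ x → deg T x ≡ 1 → x ≢ r
  leaf≢root x d refl with subst (2 ≤_) d deg-r≥2
  ... | s≤s ()

  leaf-not-centre : ∀ x → deg T x ≡ 1 → centre x ≡ false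
  leaf-not-centre x d with centre x in cx
  ... | false = refl
  ... | true = ⊥-elim (<⇒≱ (centre⇒large-region x cx ne) (≤-trans S≤1 K≥1))
    where
    ne = leaf≢root x d
    only : ∀ y → inRegion centre x y ≡ true → y ≡ x
    only y h with inRegion-sound centre x y h
    ... | [] , e , _ = trans (sym (lastV-of-path y (path x) [] e)) (path-ends x)
    ... | (g , z) ∷ s , e , _ with ancestor-deg≥2 x y ((g , z) ∷ s) ne e (λ ())
    ... | dd with subst (2 ≤_) d dd
    ... | s≤s ()
    S≤1 : regionSize centre x ≤ 1
    S≤1 = count-≤1 (inRegion centre x) (λ a b ha hb → trans (only a ha) (sym (only b hb)))

  ChildEdge : Fin n → Edge n → Set
  ChildEdge u g = g ∈ edges T × u ∈ₑ g × g ∉ pathEdges (path u)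

  childEdge? : ∀ u → Dec (Any (λ g → u ∈ₑ g × g ∉ pathEdges (path u)) (edges T))
  childEdge? u = Any.any? (λ g → (u ∈ₑ? g) ×-dec ¬? (g ∈E? pathEdges (path u))) (edges T)

  -- (u , u , u) is a junk value: only leaves have no child edge.
  childEdge : Fin n → Edge n
  childEdge u with childEdge? u
  ... | yes g = proj₁ (find g)
  ... | no _ = u , u , u

  root-childEdge : ∃ (ChildEdge r)
  root-childEdge = first (edgesAt r) deg-r≥2 (∈-filter⁻ (r ∈ₑ?_) {xs = edges T})
    where
    first : ∀ gs → 2 ≤ length gs → (∀ {g} → g ∈ gs → g ∈ edges T × r ∈ₑ g) → ∃ (ChildEdge r)
    first (g ∷ _) _ member with member (here refl)
    ... | gT , rg = g , gT , rg , subst (λ s → g ∉ pathEdges s) (sym path-root) λ ()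

  centre-childEdge : ∀ u → centre u ≡ true → ∃ (ChildEdge u)
  centre-childEdge u cu with u ≟ r
  ... | yes refl = root-childEdge
  ... | no u≢r with count≥2⇒other (inRegion centre u) u (≤-trans (s≤s K≥1) (centre⇒large-region u cu u≢r))
  ... | y , iy , y≢u with inRegion-sound centre u y iy
  ... | [] , e , _ = ⊥-elim (y≢u (trans (sym (lastV-of-path y (path u) [] e)) (path-ends u)))
  ... | (g , z) ∷ s , e , _ with path-step y (path u) g z s e
  ... | gT , ug , _ = g , gT , subst (_∈ₑ g) (path-ends u) ug , path-edge-fresh y (path u) g z s e

  childEdge-spec : ∀ u → centre u ≡ true → ChildEdge u (childEdge u)
  childEdge-spec u cu with childEdge? u
  ... | yes g = proj₁ (proj₂ (find g)) , proj₂ (proj₂ (find g))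
  ... | no none with centre-childEdge u cu
  ... | g , gT , ug , g∉ = ⊥-elim (none (lose gT (ug , g∉)))

  -- In the leg {v, w, u} at a centre u, w is another centre if the edge has one and a leaf otherwise;
  -- then w ∈ I and v ∉ I.
  chooseVW : Fin n → Fin n → Fin n × Fin n
  chooseVW p q = if centre p then (q , p) else (if centre q then (p , q) else (if ⌊ deg T p ℕₚ.≟ 1 ⌋ then (q , p) else (p , q)))

  legOf : Fin n → Edge n → Fin n × Fin n
  legOf u f = chooseVW (proj₁ (otherTwo u f)) (proj₂ (otherTwo u f))

  vOf wOf : Fin n → Edge n → Fin n
  vOf u f = proj₁ (legOf u f)
  wOf u f = proj₂ (legOf u f)

  chooseVW-cases : ∀ p q → (proj₁ (chooseVW p q) ≡ p × proj₂ (chooseVW p q) ≡ q) ⊎ (proj₁ (chooseVW p q) ≡ q × proj₂ (chooseVW p q) ≡ p)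
  chooseVW-cases p q with centre p | centre q | ⌊ deg T p ℕₚ.≟ 1 ⌋
  ... | true | _ | _ = inj₂ (refl , refl)
  ... | false | true | _ = inj₁ (refl , refl)
  ... | false | false | true = inj₂ (refl , refl)
  ... | false | false | false = inj₁ (refl , refl)

  record Leg (u : Fin n) (f : Edge n) : Set where
    field
      vf : vOf u f ∈ₑ f
      wf : wOf u f ∈ₑ f
      v≢w : vOf u f ≢ wOf u f
      v≢u : vOf u f ≢ u
      w≢u : wOf u f ≢ u
      ≈vw : f ≈ₑ (vOf u f , wOf u f , u)

  leg : ∀ u f → f ∈ edges T → u ∈ₑ f → Leg u f
  leg u f fT uf with otherTwo-spec u f (edge-is3 f fT) uf | chooseVW-cases (proj₁ (otherTwo u f)) (proj₂ (otherTwo u f))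
  ... | os | inj₁ (ev , ew) = record
        { vf = subst (_∈ₑ f) (sym ev) (OtherTwo.pf os) ; wf = subst (_∈ₑ f) (sym ew) (OtherTwo.qf os)
        ; v≢w = λ e → OtherTwo.p≢q os (trans (sym ev) (trans e ew))
        ; v≢u = λ e → OtherTwo.p≢u os (trans (sym ev) e) ; w≢u = λ e → OtherTwo.q≢u os (trans (sym ew) e)
        ; ≈vw = subst₂ (λ a b → f ≈ₑ (a , b , u)) (sym ev) (sym ew) (≈ₑ-otherTwo os uf) }
  ... | os | inj₂ (ev , ew) = record
        { vf = subst (_∈ₑ f) (sym ev) (OtherTwo.qf os) ; wf = subst (_∈ₑ f) (sym ew) (OtherTwo.pf os)
        ; v≢w = λ e → OtherTwo.p≢q os (trans (sym ew) (trans (sym e) ev))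
        ; v≢u = λ e → OtherTwo.q≢u os (trans (sym ev) e) ; w≢u = λ e → OtherTwo.p≢u os (trans (sym ew) e)
        ; ≈vw = subst₂ (λ a b → f ≈ₑ (a , b , u)) (sym ev) (sym ew) (≈ₑ-swap (≈ₑ-otherTwo os uf)) }

  no-three-centres : ∀ u f p q → f ∈ edges T → OtherTwo u f p q → centre u ≡ true → centre p ≡ true → centre q ≡ true → ⊥
  no-three-centres u f p q fT os cu cp cq with has-leaf f fT
  ... | ℓ , ℓf , dℓ with leaf-not-centre ℓ dℓ | OtherTwo.all os ℓ ℓf
  ... | cℓ | inj₁ refl with trans (sym cu) cℓ
  ... | ()
  no-three-centres u f p q fT os cu cp cq | ℓ , ℓf , dℓ | cℓ | inj₂ (inj₁ refl) with trans (sym cp) cℓ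
  ... | ()
  no-three-centres u f p q fT os cu cp cq | ℓ , ℓf , dℓ | cℓ | inj₂ (inj₂ refl) with trans (sym cq) cℓ
  ... | ()

  w-centre-or-leaf′ : ∀ u f p q → f ∈ edges T → OtherTwo u f p q → centre u ≡ true →
        centre (proj₂ (chooseVW p q)) ≡ true ⊎ (centre (proj₂ (chooseVW p q)) ≡ false × deg T (proj₂ (chooseVW p q)) ≡ 1)
  w-centre-or-leaf′ u f p q fT os cu with centre p in cp
  ... | true = inj₁ cp
  ... | false with centre q in cq
  ... | true = inj₁ cq
  ... | false with deg T p ℕₚ.≟ 1
  ... | yes d = inj₂ (cp , d)
  ... | no nd with has-leaf f fT
  ... | ℓ , ℓf , dℓ with OtherTwo.all os ℓ ℓf
  ... | inj₁ refl with trans (sym cu) (leaf-not-centre ℓ dℓ)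
  ... | ()
  w-centre-or-leaf′ u f p q fT os cu | false | false | no nd | ℓ , ℓf , dℓ | inj₂ (inj₁ refl) = ⊥-elim (nd dℓ)
  w-centre-or-leaf′ u f p q fT os cu | false | false | no nd | ℓ , ℓf , dℓ | inj₂ (inj₂ refl) = inj₂ (cq , dℓ)

  v-not-centre′ : ∀ u f p q → f ∈ edges T → OtherTwo u f p q → centre u ≡ true → centre (proj₁ (chooseVW p q)) ≡ false
  v-not-centre′ u f p q fT os cu with centre p in cp
  ... | true with centre q in cq
  ... | true = ⊥-elim (no-three-centres u f p q fT os cu cp cq)
  ... | false = refl
  v-not-centre′ u f p q fT os cu | false with centre q in cq
  ... | true = cp
  ... | false with ⌊ deg T p ℕₚ.≟ 1 ⌋
  ... | true = cq
  ... | false = cp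

  w-is-centre′ : ∀ u f p q → f ∈ edges T → OtherTwo u f p q → centre u ≡ true → ∀ z → z ∈ₑ f → z ≢ u → centre z ≡ true →
        proj₂ (chooseVW p q) ≡ z
  w-is-centre′ u f p q fT os cu z zf zu cz with OtherTwo.all os z zf
  ... | inj₁ e = ⊥-elim (zu e)
  ... | inj₂ (inj₁ refl) rewrite cz = refl
  ... | inj₂ (inj₂ refl) with centre p in cp
  ... | true = ⊥-elim (no-three-centres u f p z fT os cu cp cz)
  ... | false rewrite cz = refl

  w-centre-or-leaf : ∀ u f → f ∈ edges T → u ∈ₑ f → centre u ≡ true → centre (wOf u f) ≡ true ⊎ (centre (wOf u f) ≡ false × deg T (wOf u f) ≡ 1)
  w-centre-or-leaf u f fT uf cu = w-centre-or-leaf′ u f _ _ fT (otherTwo-spec u f (edge-is3 f fT) uf) cu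

  v-not-centre : ∀ u f → f ∈ edges T → u ∈ₑ f → centre u ≡ true → centre (vOf u f) ≡ false
  v-not-centre u f fT uf cu = v-not-centre′ u f _ _ fT (otherTwo-spec u f (edge-is3 f fT) uf) cu

  w-is-centre : ∀ u f → f ∈ edges T → u ∈ₑ f → centre u ≡ true → ∀ z → z ∈ₑ f → z ≢ u → centre z ≡ true → wOf u f ≡ z
  w-is-centre u f fT uf cu = w-is-centre′ u f _ _ fT (otherTwo-spec u f (edge-is3 f fT) uf) cu

  abstract
    isLegW? : ∀ x → Dec (Any (λ f → ∃ λ u → u ∈ₑ f × centre u ≡ true × x ≡ wOf u f) (edges T))
    isLegW? x = Any.any? (λ f → any? (λ u → (u ∈ₑ? f) ×-dec (centre u Bool.≟ true) ×-dec (x ≟ wOf u f))) (edges T)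

    isLegW : Fin n → Bool
    isLegW x = does (isLegW? x)

    isLegW-sound : ∀ x → isLegW x ≡ true → ∃ λ f → ∃ λ u → f ∈ edges T × u ∈ₑ f × centre u ≡ true × x ≡ wOf u f
    isLegW-sound x h with find (does⇒ (isLegW? x) h)
    ... | f , fT , u , uf , cu , e = f , u , fT , uf , cu , e

    isLegW-complete : ∀ x f u → f ∈ edges T → u ∈ₑ f → centre u ≡ true → x ≡ wOf u f → isLegW x ≡ true
    isLegW-complete x f u fT uf cu e = dec-true (isLegW? x) (lose fT (u , uf , cu , e))

  inI : Fin n → Bool
  inI x = centre x ∨ isLegW x

  v∉I : ∀ u f → f ∈ edges T → u ∈ₑ f → centre u ≡ true → inI (vOf u f) ≡ false
  v∉I u f fT uf cu with v-not-centre u f fT uf cu | isLegW (vOf u f) in iw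
  ... | cv | false rewrite cv = refl
  ... | cv | true with isLegW-sound (vOf u f) iw
  ... | f' , u' , f'T , u'f' , cu' , ev with w-centre-or-leaf u' f' f'T u'f' cu'
  ... | inj₁ cw = ⊥-elim (false≢true (trans (sym cv) (trans (cong centre ev) cw)))
  ... | inj₂ (_ , dw) with f ≟E f'
  ... | no ne = ⊥-elim (lt (subst (λ z → 2 ≤ deg T z) (sym ev) (two-edges⇒deg≥2 (wOf u' f') f f' fT f'T (subst (_∈ₑ f) ev (Leg.vf (leg u f fT uf))) (Leg.wf (leg u' f' f'T u'f')) ne)))
    where lt : ¬ (2 ≤ deg T (vOf u f))
          lt h with subst (2 ≤_) (trans (cong (deg T) ev) dw) h
          ... | s≤s ()
  ... | yes refl with u' ≟ u
  ... | yes refl = ⊥-elim (Leg.v≢w (leg u f fT uf) ev)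
  ... | no u'u = ⊥-elim (Leg.v≢u (leg u f fT uf) (trans ev (w-is-centre u' f fT u'f' cu' u uf (λ e → u'u (sym e)) cu)))

  touchesCentre : Edge n → Bool
  touchesCentre (a , b , c) = centre a ∨ (centre b ∨ centre c)

  touchesCentre-intro : ∀ x f → x ∈ₑ f → centre x ≡ true → touchesCentre f ≡ true
  touchesCentre-intro x (a , b , c) (inj₁ refl) cx rewrite cx = refl
  touchesCentre-intro x (a , b , c) (inj₂ (inj₁ refl)) cx rewrite cx | ∨-zeroʳ (centre a) = refl
  touchesCentre-intro x (a , b , c) (inj₂ (inj₂ refl)) cx rewrite cx | ∨-zeroʳ (centre b) | ∨-zeroʳ (centre a) = refl

  touchesCentre-elim : ∀ f → touchesCentre f ≡ true → ∃ λ x → x ∈ₑ f × centre x ≡ true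
  touchesCentre-elim (a , b , c) h with ∨-true {centre a} h
  ... | inj₁ e = a , inj₁ refl , e
  ... | inj₂ e with ∨-true {centre b} e
  ... | inj₁ e' = b , inj₂ (inj₁ refl) , e'
  ... | inj₂ e' = c , inj₂ (inj₂ refl) , e'

  centre-free-edge⇒∉I : ∀ f x → f ∈ edges T → touchesCentre f ≡ false → x ∈ₑ f → inI x ≡ false
  centre-free-edge⇒∉I f x fT hf xf with centre x in cx
  ... | true with trans (sym (touchesCentre-intro x f xf cx)) hf
  ... | ()
  centre-free-edge⇒∉I f x fT hf xf | false with isLegW x in iw
  ... | false = refl
  ... | true with isLegW-sound x iw
  ... | f' , u' , f'T , u'f' , cu' , ex with w-centre-or-leaf u' f' f'T u'f' cu'
  ... | inj₁ cw with trans (sym cx) (trans (cong centre ex) cw)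
  ... | ()
  centre-free-edge⇒∉I f x fT hf xf | false | true | f' , u' , f'T , u'f' , cu' , ex | inj₂ (_ , dw) with f ≟E f'
  ... | no ne = ⊥-elim (lt (two-edges⇒deg≥2 x f f' fT f'T xf (subst (_∈ₑ f') (sym ex) (Leg.wf (leg u' f' f'T u'f'))) ne))
    where lt : ¬ (2 ≤ deg T x)
          lt h with subst (2 ≤_) (trans (cong (deg T) ex) dw) h
          ... | s≤s ()
  ... | yes refl with trans (sym (touchesCentre-intro u' f u'f' cu')) hf
  ... | ()

  I∖centre⇒leaf-w : ∀ x → inI x ≡ true → centre x ≡ false →
       ∃ λ f → ∃ λ u → f ∈ edges T × u ∈ₑ f × centre u ≡ true × x ≡ wOf u f × deg T x ≡ 1
  I∖centre⇒leaf-w x ix cx with isLegW x in iw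
  ... | false rewrite cx with ix
  ... | ()
  I∖centre⇒leaf-w x ix cx | true with isLegW-sound x iw
  ... | f , u , fT , uf , cu , ex with w-centre-or-leaf u f fT uf cu
  ... | inj₁ cw with trans (sym cx) (trans (cong centre ex) cw)
  ... | ()
  I∖centre⇒leaf-w x ix cx | true | f , u , fT , uf , cu , ex | inj₂ (_ , dw) = f , u , fT , uf , cu , ex , trans (cong (deg T) ex) dw

  leaf-edge-unique : ∀ x f g → deg T x ≡ 1 → f ∈ edges T → g ∈ edges T → x ∈ₑ f → x ∈ₑ g → f ≡ g
  leaf-edge-unique x f g d fT gT xf xg with f ≟E g
  ... | yes e = e
  ... | no ne with subst (2 ≤_) d (two-edges⇒deg≥2 x f g fT gT xf xg ne)
  ... | s≤s ()

  -- Tops and parts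

  CentreFree : List (Step {n}) → Set
  CentreFree [] = ⊤
  CentreFree ((f , x) ∷ s) = touchesCentre f ≡ false × CentreFree s

  topFrom : Fin n → List (Step {n}) → Fin n
  topFrom t [] = t
  topFrom t ((f , x) ∷ s) = topFrom (if touchesCentre f then x else t) s

  -- The parts are the fibres of top on V ∖ I: the top of y is the end of the last edge
  -- touching a centre on the root path of y.
  top : Fin n → Fin n
  top y = topFrom r (path y)

  topFrom-++ : ∀ t a b → topFrom t (a ++ b) ≡ topFrom (topFrom t a) b
  topFrom-++ t [] b = refl
  topFrom-++ t ((f , x) ∷ a) b = topFrom-++ _ a b

  topFrom-CentreFree : ∀ t s → CentreFree s → topFrom t s ≡ t
  topFrom-CentreFree t [] _ = refl
  topFrom-CentreFree t ((f , x) ∷ s) (h , hs) rewrite h = topFrom-CentreFree t s hs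

  topFrom-∷ʳ-centre : ∀ t a f x → touchesCentre f ≡ true → topFrom t (a ++ [ (f , x) ]) ≡ x
  topFrom-∷ʳ-centre t a f x h rewrite topFrom-++ t a [ (f , x) ] | h = refl

  lastTouchesCentre : List (Step {n}) → Bool
  lastTouchesCentre [] = false
  lastTouchesCentre ((f , x) ∷ []) = touchesCentre f
  lastTouchesCentre (_ ∷ y ∷ s) = lastTouchesCentre (y ∷ s)

  lastTouchesCentre-∷ʳ : ∀ a f x → lastTouchesCentre (a ++ [ (f , x) ]) ≡ touchesCentre f
  lastTouchesCentre-∷ʳ [] f x = refl
  lastTouchesCentre-∷ʳ (y ∷ []) f x = refl
  lastTouchesCentre-∷ʳ (y ∷ z ∷ a) f x = lastTouchesCentre-∷ʳ (z ∷ a) f x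

  lastTouchesCentre-elim : ∀ s → lastTouchesCentre s ≡ true → ∃ λ a → ∃ λ f → ∃ λ x → s ≡ a ++ [ (f , x) ] × touchesCentre f ≡ true
  lastTouchesCentre-elim s h with init-last s (λ { refl → false≢true h })
  ... | a , (f , x) , refl = a , f , x , refl , trans (sym (lastTouchesCentre-∷ʳ a f x)) h

  last-centre-edge : ∀ (s : List (Step {n})) → CentreFree s ⊎ (∃ λ a → ∃ λ f → ∃ λ z → ∃ λ b → s ≡ a ++ (f , z) ∷ b × touchesCentre f ≡ true × CentreFree b)
  last-centre-edge [] = inj₁ tt
  last-centre-edge ((f , z) ∷ s) with last-centre-edge s
  ... | inj₂ (a , g , w , b , e , h , cf) = inj₂ ((f , z) ∷ a , g , w , b , cong ((f , z) ∷_) e , h , cf)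
  ... | inj₁ cf with touchesCentre f in hf
  ... | true = inj₂ ([] , f , z , s , refl , hf , cf)
  ... | false = inj₁ (refl , cf)

  isTop : Fin n → Bool
  isTop t = not (inI t) ∧ lastTouchesCentre (path t)

  top-spec : ∀ y → inI y ≡ false → isTop (top y) ≡ true × ∃ λ a → path y ≡ path (top y) ++ a × CentreFree a
  top-spec y iy with last-centre-edge (path y) in eqd
  ... | inj₁ cf = ⊥-elim (noCF (path y) refl cf)
    where
    noCF : ∀ s → path y ≡ s → CentreFree s → ⊥
    noCF [] e _ with trans (sym (path-ends y)) (cong (lastV r) e)
    ... | refl with trans (sym iy) (cong (_∨ isLegW r) centre-root)
    ... | ()
    noCF ((f , z) ∷ s) e (hf , _) with path-step y [] f z s e
    ... | fT , rf , _ with trans (sym (touchesCentre-intro r f rf centre-root)) hf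
    ... | ()
  ... | inj₂ (a , f , z , b , e , hc , cf) = istop , b , pyeq , cf
    where
    e' : path y ≡ (a ++ [ (f , z) ]) ++ b
    e' = trans e (sym (++-assoc a [ (f , z) ] b))
    tz : top y ≡ z
    tz = trans (cong (topFrom r) e') (trans (topFrom-++ r (a ++ [ (f , z) ]) b)
           (trans (cong (λ t → topFrom t b) (topFrom-∷ʳ-centre r a f z hc)) (topFrom-CentreFree z b cf)))
    lz : lastV r (a ++ [ (f , z) ]) ≡ z
    lz = lastV-++ r a [ (f , z) ]
    pz : path z ≡ a ++ [ (f , z) ]
    pz = trans (cong path (sym lz)) (path-prefix y (a ++ [ (f , z) ]) b e')
    zI : ∀ b → path y ≡ (a ++ [ (f , z) ]) ++ b → CentreFree b → inI z ≡ false
    zI [] e2 _ = subst (λ w → inI w ≡ false) (sym (trans (sym lz) (lastV-of-path y (a ++ [ (f , z) ]) [] e2))) iy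
    zI ((g , w) ∷ b) e2 (hg , _) with path-step y (a ++ [ (f , z) ]) g w b e2
    ... | gT , zg , _ = centre-free-edge⇒∉I g z gT hg (subst (_∈ₑ g) lz zg)
    istop : isTop (top y) ≡ true
    istop rewrite tz | zI b e' cf | pz | lastTouchesCentre-∷ʳ a f z = hc
    pyeq : path y ≡ path (top y) ++ b
    pyeq rewrite tz | pz = e'

  top-of-top : ∀ t → isTop t ≡ true → top t ≡ t
  top-of-top t h with lastTouchesCentre-elim (path t) (proj₂ (∧-true {not (inI t)} h))
  ... | a , f , x , e , hc = trans (cong (topFrom r) e) (trans (topFrom-∷ʳ-centre r a f x hc) (sym (trans (sym (path-ends t)) (trans (cong (lastV r) e) (lastV-++ r a _)))))

  top-CentreFree-extension : ∀ x y s → path y ≡ path x ++ s → CentreFree s → top y ≡ top x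
  top-CentreFree-extension x y s e cf = trans (cong (topFrom r) e) (trans (topFrom-++ r (path x) s) (topFrom-CentreFree _ s cf))

  tops : List (Fin n)
  tops = filter (λ t → isTop t Bool.≟ true) (allFin n)

  l : ℕ
  l = length tops

  tops-Unique : Unique tops
  tops-Unique = Uniqueₚ.filter⁺ _ (Uniqueₚ.allFin⁺ n)

  tops-isTop : ∀ p → isTop (lookup tops p) ≡ true
  tops-isTop p = proj₂ (∈-filter⁻ (λ t → isTop t Bool.≟ true) {xs = allFin n} (∈-lookup p))

  isTop⇒∈tops : ∀ t → isTop t ≡ true → t ∈ tops
  isTop⇒∈tops t h = ∈-filter⁺ (λ t → isTop t Bool.≟ true) (∈-allFin t) h

  part : Fin n → Maybe (Fin l)
  part y = if inI y then nothing else indexOf _≟_ tops (top y)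

  part-just : ∀ y p → part y ≡ just p → inI y ≡ false × top y ≡ lookup tops p
  part-just y p e with inI y
  ... | false = refl , sym (indexOf-sound _≟_ tops (top y) e)

  part-of : ∀ y → inI y ≡ false → ∃ λ p → part y ≡ just p
  part-of y iy with indexOf-complete _≟_ tops (top y) (isTop⇒∈tops (top y) (proj₁ (top-spec y iy)))
  ... | p , e rewrite iy = p , e

  part-cong : ∀ x y → inI x ≡ false → inI y ≡ false → top x ≡ top y → part x ≡ part y
  part-cong x y ix iy e rewrite ix | iy | e = refl

  part-top : ∀ p → part (lookup tops p) ≡ just p
  part-top p with part-of (lookup tops p) (not-true (proj₁ (∧-true (tops-isTop p))))
  ... | q , e with part-just _ q e
  ... | _ , tq = trans e (cong just (lookup-injective tops tops-Unique q p (sym (trans (sym (top-of-top _ (tops-isTop p))) tq))))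

  centre-free-edge-top : ∀ f → f ∈ edges T → touchesCentre f ≡ false → ∃ λ a → a ∈ₑ f × ∀ x → x ∈ₑ f → top x ≡ top a
  centre-free-edge-top f fT hf with edge-top f fT
  ... | a , af , nf = a , af , λ x xf → aux x xf (x ≟ a)
    where
    aux : ∀ x → x ∈ₑ f → Dec (x ≡ a) → top x ≡ top a
    aux x xf (yes e) = cong top e
    aux x xf (no ne) = top-CentreFree-extension a x [ (f , x) ] (path-across-edge f a fT af nf x xf ne) (hf , tt)

  centre-free-edge-part : ∀ f → f ∈ edges T → touchesCentre f ≡ false → ∀ x y → x ∈ₑ f → y ∈ₑ f → part x ≡ part y
  centre-free-edge-part f fT hf x y xf yf with centre-free-edge-top f fT hf
  ... | a , af , h = part-cong x y (centre-free-edge⇒∉I f x fT hf xf) (centre-free-edge⇒∉I f y fT hf yf) (trans (h x xf) (sym (h y yf)))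

  centres : List (Fin n)
  centres = filter (λ t → centre t Bool.≟ true) (allFin n)

  centreAt : Fin (length centres) → Fin n
  centreAt j = lookup centres j

  centres-Unique : Unique centres
  centres-Unique = Uniqueₚ.filter⁺ _ (Uniqueₚ.allFin⁺ n)

  centreAt-centre : ∀ j → centre (centreAt j) ≡ true
  centreAt-centre j = proj₂ (∈-filter⁻ (λ t → centre t Bool.≟ true) {xs = allFin n} (∈-lookup j))

  centreAt-of : ∀ u → centre u ≡ true → ∃ λ j → centreAt j ≡ u
  centreAt-of u cu = index m , sym (lookup-index m)
    where m = ∈-filter⁺ (λ t → centre t Bool.≟ true) (∈-allFin u) cu

  legs : (j : Fin (length centres)) → Fin (deg T (centreAt j)) → Fin n × Fin n
  legs j i = legOf (centreAt j) (lookup (edgesAt (centreAt j)) i)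

  edgesAt-lookup : ∀ u i → lookup (edgesAt u) i ∈ edges T × u ∈ₑ lookup (edgesAt u) i
  edgesAt-lookup u i = ∈-filter⁻ (u ∈ₑ?_) {xs = edges T} (∈-lookup i)

  edgesAt-Unique : ∀ u → Unique (edgesAt u)
  edgesAt-Unique u = Uniqueₚ.filter⁺ _ edges-Unique

  edgesAt-index : ∀ u f → f ∈ edges T → u ∈ₑ f → ∃ λ i → f ≡ lookup (edgesAt u) i
  edgesAt-index u f fT uf = index m , lookup-index m
    where m = ∈-filter⁺ (u ∈ₑ?_) fT uf

  centre-star : ∀ u → centre u ≡ true → IsStar T u (λ i → legOf u (lookup (edgesAt u) i))
  centre-star u cu = s1 , s2 , s3
    where
    fi : Fin (deg T u) → Edge n
    fi i = lookup (edgesAt u) i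
    Lg : ∀ i → Leg u (fi i)
    Lg i = leg u (fi i) (proj₁ (edgesAt-lookup u i)) (proj₂ (edgesAt-lookup u i))
    s1 : ∀ i → ∃ λ f → f ∈ edges T × f ≈ₑ (vOf u (fi i) , wOf u (fi i) , u)
    s1 i = fi i , proj₁ (edgesAt-lookup u i) , Leg.≈vw (Lg i)
    s2 : ∀ f → f ∈ edges T → u ∈ₑ f → ∃ λ i → f ≈ₑ (vOf u (fi i) , wOf u (fi i) , u)
    s2 f fT uf with edgesAt-index u f fT uf
    ... | i , e = i , subst (λ g → f ≈ₑ (vOf u g , wOf u g , u)) e (Leg.≈vw (leg u f fT uf))
    sameEdge : ∀ i j x → x ≢ u → x ∈ₑ fi i → x ∈ₑ fi j → i ≡ j
    sameEdge i j x xu xi xj = lookup-injective (edgesAt u) (edgesAt-Unique u) i j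
      (two-common-vertices⇒≡ (fi i) (fi j) u x (proj₁ (edgesAt-lookup u i)) (proj₁ (edgesAt-lookup u j)) (λ e → xu (sym e))
        (proj₂ (edgesAt-lookup u i)) xi (proj₂ (edgesAt-lookup u j)) xj)
    vv ww : Fin (deg T u) → Fin n
    vv i = vOf u (fi i)
    ww i = wOf u (fi i)
    vv-inj : ∀ {i j} → vv i ≡ vv j → i ≡ j
    vv-inj {i} {j} e = sameEdge i j (vv i) (Leg.v≢u (Lg i)) (Leg.vf (Lg i)) (subst (_∈ₑ fi j) (sym e) (Leg.vf (Lg j)))
    ww-inj : ∀ {i j} → ww i ≡ ww j → i ≡ j
    ww-inj {i} {j} e = sameEdge i j (ww i) (Leg.w≢u (Lg i)) (Leg.wf (Lg i)) (subst (_∈ₑ fi j) (sym e) (Leg.wf (Lg j)))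
    disj : ∀ {x} → ¬ (x ∈ map vv (allFin _) × x ∈ map ww (allFin _))
    disj (m1 , m2) with ∈-map⁻ vv m1 | ∈-map⁻ ww m2
    ... | i , _ , refl | j , _ , e with sameEdge i j (vv i) (Leg.v≢u (Lg i)) (Leg.vf (Lg i)) (subst (_∈ₑ fi j) (sym e) (Leg.wf (Lg j)))
    ... | refl = Leg.v≢w (Lg i) e
    uNot : u ∉ (map vv (allFin _) ++ map ww (allFin _))
    uNot m with ∈-++⁻ (map vv (allFin _)) m
    ... | inj₁ m1 with ∈-map⁻ vv m1
    ... | i , _ , e = Leg.v≢u (Lg i) (sym e)
    uNot m | inj₂ m2 with ∈-map⁻ ww m2
    ... | i , _ , e = Leg.w≢u (Lg i) (sym e)
    s3 : Unique (u ∷ (map vv (allFin _) ++ map ww (allFin _)))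
    s3 = Unique-∷⁺ uNot (Uniqueₚ.++⁺ (Uniqueₚ.map⁺ vv-inj (Uniqueₚ.allFin⁺ _)) (Uniqueₚ.map⁺ ww-inj (Uniqueₚ.allFin⁺ _)) disj)

  Remaining : Edge n → Set
  Remaining f = f ∈ edges T × ¬ (∃ λ j → ∃ λ i → f ≈ₑ (proj₁ (legs j i) , proj₂ (legs j i) , centreAt j))

  Remaining⇒centre-free : ∀ f → Remaining f → touchesCentre f ≡ false
  Remaining⇒centre-free f (fT , nr) with touchesCentre f in hf
  ... | false = refl
  ... | true with touchesCentre-elim f hf
  ... | x , xf , cx with centreAt-of x cx
  ... | j , refl with proj₁ (proj₂ (centre-star (centreAt j) (centreAt-centre j))) f fT xf
  ... | i , e = ⊥-elim (nr (j , i , e))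

  centre-free⇒Remaining : ∀ f → f ∈ edges T → touchesCentre f ≡ false → Remaining f
  centre-free⇒Remaining f fT hf = fT , λ { (j , i , e) → false≢true (sym (trans (sym (touchesCentre-intro (centreAt j) f (proj₂ (e (centreAt j)) (inj₂ (inj₂ refl))) (centreAt-centre j))) hf)) }

  edge-inside : ∀ f → Remaining f → ∃ λ p → ∀ x → x ∈ₑ f → part x ≡ just p
  edge-inside f rf with centre-free-edge-top f (proj₁ rf) (Remaining⇒centre-free f rf)
  ... | a , af , _ with part-of a (centre-free-edge⇒∉I f a (proj₁ rf) (Remaining⇒centre-free f rf) af)
  ... | p , e = p , λ x xf → trans (centre-free-edge-part f (proj₁ rf) (Remaining⇒centre-free f rf) x a xf af) e

  module PartTree (p : Fin l) where
    InPart : Fin n → Set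
    InPart x = part x ≡ just p

    PartEdge : Edge n → Set
    PartEdge f = Remaining f × (∀ x → x ∈ₑ f → part x ≡ just p)

    ValidSteps-in-part : ∀ z s → part z ≡ just p → ValidSteps InT z s → CentreFree s → ValidSteps PartEdge z s
    ValidSteps-in-part z [] _ _ _ = tt
    ValidSteps-in-part z ((f , y) ∷ s) pz (fT , zf , yf , valid) (hf , cf) =
      (centre-free⇒Remaining f fT hf , in-part) , zf , yf , ValidSteps-in-part y s (in-part y yf) valid cf
      where
      in-part : ∀ x → x ∈ₑ f → part x ≡ just p
      in-part x xf = trans (centre-free-edge-part f fT hf x z xf zf) pz

    t : Fin n
    t = lookup tops p

    walk-from-top : ∀ x → InPart x → ∃ λ a → ValidSteps PartEdge t a × lastV t a ≡ x
    walk-from-top x px =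
      a , ValidSteps-in-part t a (part-top p) valid cf , trans (cong (λ w → lastV w a) (sym (path-ends t))) (lastV-of-path x (path t) a path≡)
      where
      PJ = part-just x p px
      TS = top-spec x (proj₁ PJ)
      a = proj₁ (proj₂ TS)
      cf : CentreFree a
      cf = proj₂ (proj₂ (proj₂ TS))
      path≡ : path x ≡ path t ++ a
      path≡ = subst (λ w → path x ≡ path w ++ a) (proj₂ PJ) (proj₁ (proj₂ (proj₂ TS)))
      valid : ValidSteps InT t a
      valid = subst (λ w → ValidSteps InT w a) (path-ends t)
                (proj₂ (ValidSteps-++⁻ InT r (path t) a (subst (ValidSteps InT r) path≡ (proj₁ (path-IsPath x)))))

    -- Walk back from x to the top and on to y, then shortcut; paths inside a part are paths of T.
    tree : IsHypertreeOn InPart PartEdge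
    tree = (λ f h v m → proj₂ h v m) , connected-in-part , unique-in-part
      where
      connected-in-part : ∀ x y → InPart x → InPart y → ∃ λ s → IsPath PartEdge x y s
      connected-in-part x y px py =
        proj₁ W , subst₂ (λ a b → IsPath PartEdge a b (proj₁ W)) (proj₂ (proj₂ X)) ends (proj₂ W)
        where
        X = walk-from-top x px
        Y = walk-from-top y py
        ax = proj₁ X
        ay = proj₁ Y
        back = ValidSteps-reverse PartEdge t ax (proj₁ (proj₂ X))
        W = walk⇒path PartEdge (lastV t ax) (reverseSteps t ax ++ ay)
              (ValidSteps-++⁺ PartEdge (lastV t ax) (reverseSteps t ax) ay (proj₁ back)
                (subst (λ w → ValidSteps PartEdge w ay) (sym (proj₂ back)) (proj₁ (proj₂ Y))))
        ends : lastV (lastV t ax) (reverseSteps t ax ++ ay) ≡ y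
        ends = trans (lastV-++ (lastV t ax) (reverseSteps t ax) ay)
                     (trans (cong (λ w → lastV w ay) (proj₂ back)) (proj₂ (proj₂ Y)))
      unique-in-part : ∀ x y s s′ → IsPath PartEdge x y s → IsPath PartEdge x y s′ → s ≡ s′
      unique-in-part x y s s′ (v₁ , a₁ , b₁ , c₁) (v₂ , a₂ , b₂ , c₂) =
        paths-unique x y s s′ (ValidSteps-map PartEdge weaken x s v₁ , a₁ , b₁ , c₁) (ValidSteps-map PartEdge weaken x s′ v₂ , a₂ , b₂ , c₂)
        where
        weaken : ∀ {f} → PartEdge f → InT f
        weaken h = proj₁ (proj₁ h)

  I : S.Subset n
  I = Vec.tabulate inI

  ∈I⇒inI : ∀ x → x S.∈ I → inI x ≡ true
  ∈I⇒inI x m = trans (sym (Vecₚ.lookup∘tabulate inI x)) (Vecₚ.[]=⇒lookup m)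

  inI⇒∈I : ∀ x → inI x ≡ true → x S.∈ I
  inI⇒∈I x h = Vecₚ.lookup⇒[]= x I (trans (Vecₚ.lookup∘tabulate inI x) h)

  part-yes : ∀ x → inI x ≡ true → part x ≡ nothing
  part-yes x h = cong (λ b → if b then nothing else indexOf _≟_ tops (top x)) h

  part-I : ∀ x → part x ≡ nothing → x S.∈ I
  part-I x e with Bool-cases (inI x)
  ... | inj₁ ix = inI⇒∈I x ix
  ... | inj₂ ix with part-of x ix
  ... | p , e' with trans (sym e) e'
  ... | ()

  I-part : ∀ x → x S.∈ I → part x ≡ nothing
  I-part x m = part-yes x (∈I⇒inI x m)

  part-nonempty : ∀ p → ∃ λ x → part x ≡ just p
  part-nonempty p = lookup tops p , part-top p

  I-isolated : ∀ x → x S.∈ I → ∀ f → Remaining f → ¬ (x ∈ₑ f)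
  I-isolated x m f rf xf with trans (sym (∈I⇒inI x m)) (centre-free-edge⇒∉I f x (proj₁ rf) (Remaining⇒centre-free f rf) xf)
  ... | ()

  cond6a : ∀ x → x S.∈ I → ∃ λ j → x ≡ centreAt j ⊎ ∃ λ i → x ≡ proj₂ (legs j i)
  cond6a x m with centre x in cx
  ... | true with centreAt-of x cx
  ... | j , e = j , inj₁ (sym e)
  cond6a x m | false with I∖centre⇒leaf-w x (∈I⇒inI x m) cx
  ... | f , u , fT , uf , cu , ex , _ with centreAt-of u cu
  ... | j , refl with edgesAt-index (centreAt j) f fT uf
  ... | i , fe = j , inj₂ (i , trans ex (cong (wOf (centreAt j)) fe))

  cond6b : ∀ j → centreAt j S.∈ I
  cond6b j = inI⇒∈I (centreAt j) (cong (_∨ isLegW (centreAt j)) (centreAt-centre j))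

  cond6c : ∀ j i → proj₂ (legs j i) S.∈ I
  cond6c j i = inI⇒∈I _ (trans (cong (centre (proj₂ (legs j i)) ∨_) iw) (∨-zeroʳ _))
    where
    iw : isLegW (proj₂ (legs j i)) ≡ true
    iw = isLegW-complete _ (lookup (edgesAt (centreAt j)) i) (centreAt j) (proj₁ (edgesAt-lookup (centreAt j) i)) (proj₂ (edgesAt-lookup (centreAt j) i)) (centreAt-centre j) refl

  cond6d : ∀ j i → ¬ (proj₁ (legs j i) S.∈ I)
  cond6d j i m with trans (sym (∈I⇒inI _ m)) (v∉I (centreAt j) (lookup (edgesAt (centreAt j)) i) (proj₁ (edgesAt-lookup (centreAt j) i)) (proj₂ (edgesAt-lookup (centreAt j) i)) (centreAt-centre j))
  ... | ()

  initSteps : List (Step {n}) → List (Step {n})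
  initSteps [] = []
  initSteps (x ∷ []) = []
  initSteps (x ∷ y ∷ s) = x ∷ initSteps (y ∷ s)

  initSteps-∷ʳ : ∀ a z → initSteps (a ++ [ z ]) ≡ a
  initSteps-∷ʳ [] z = refl
  initSteps-∷ʳ (x ∷ []) z = refl
  initSteps-∷ʳ (x ∷ y ∷ a) z = cong (x ∷_) (initSteps-∷ʳ (y ∷ a) z)

  lastEdge : List (Step {n}) → Edge n
  lastEdge [] = (r , r , r)
  lastEdge (x ∷ []) = proj₁ x
  lastEdge (x ∷ y ∷ s) = lastEdge (y ∷ s)

  lastEdge-∷ʳ : ∀ a f x → lastEdge (a ++ [ (f , x) ]) ≡ f
  lastEdge-∷ʳ [] f x = refl
  lastEdge-∷ʳ (y ∷ []) f x = refl
  lastEdge-∷ʳ (y ∷ z ∷ a) f x = lastEdge-∷ʳ (z ∷ a) f x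

  parent : Fin n → Fin n
  parent x = lastV r (initSteps (path x))

  parentEdge : Fin n → Edge n
  parentEdge x = lastEdge (path x)

  otherOf : Fin n → Fin n → Edge n → Fin n
  otherOf u t f = thirdOf t (proj₁ (otherTwo u f)) (proj₂ (otherTwo u f))

  sibling : Fin n → Fin n
  sibling x = otherOf (parent x) x (parentEdge x)

  record Parent (x : Fin n) : Set where
    field
      prefix : List (Step {n})
      edge : Edge n
      path≡ : path x ≡ prefix ++ [ (edge , x) ]
      edge∈T : edge ∈ edges T
      x∈edge : x ∈ₑ edge
      parent∈edge : parent x ∈ₑ edge
      parentEdge≡ : parentEdge x ≡ edge
      parent≡ : parent x ≡ lastV r prefix
      sibling-third : ThirdVertex (parent x) x (sibling x) edge
      path-sibling≡ : path (sibling x) ≡ prefix ++ [ (edge , sibling x) ]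
      otherOf-sibling : otherOf (parent x) (sibling x) edge ≡ x

  parent-spec : ∀ x → x ≢ r → Parent x
  parent-spec x ≢root = record
    { prefix = a ; edge = f ; path≡ = eq ; edge∈T = fT ; x∈edge = xf ; parent∈edge = pf ; parentEdge≡ = pe≡ ; parent≡ = par≡
    ; sibling-third = o2' ; path-sibling≡ = Psib ; otherOf-sibling = sibsib }
    where
    NR = path-last-step x ≢root
    a = proj₁ NR
    f = proj₁ (proj₂ NR)
    eq : path x ≡ a ++ [ (f , x) ]
    eq = proj₂ (proj₂ NR)
    SA = path-step x a f x [] eq
    fT = proj₁ SA
    xf : x ∈ₑ f
    xf = proj₂ (proj₂ SA)
    par≡ : parent x ≡ lastV r a
    par≡ = cong (lastV r) (trans (cong initSteps eq) (initSteps-∷ʳ a _))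
    pf : parent x ∈ₑ f
    pf = subst (_∈ₑ f) (sym par≡) (proj₁ (proj₂ SA))
    pe≡ : parentEdge x ≡ f
    pe≡ = trans (cong lastEdge eq) (lastEdge-∷ʳ a f x)
    Ppar : path (parent x) ≡ a
    Ppar = trans (cong path par≡) (path-prefix x a _ eq)
    px : parent x ≢ x
    px e = ∷ʳ-length-≢ a (f , x) (trans (sym Ppar) (trans (cong path e) eq))
    os = otherTwo-spec (parent x) f (edge-is3 f fT) pf
    o2' : ThirdVertex (parent x) x (sibling x) f
    o2' = subst (λ g → ThirdVertex (parent x) x (otherOf (parent x) x g) f) (sym pe≡)
            (thirdOf-spec (parent x) x _ _ f os xf (λ e → px (sym e)))
    Psib : path (sibling x) ≡ a ++ [ (f , sibling x) ]
    Psib = subst (λ w → path (sibling x) ≡ w ++ [ (f , sibling x) ]) Ppar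
             (path-sibling f (parent x) x (subst (λ w → path x ≡ w ++ [ (f , x) ]) (sym Ppar) eq) (sibling x) (ThirdVertex.∈f o2') (ThirdVertex.≢u o2'))
    sibsib : otherOf (parent x) (sibling x) f ≡ x
    sibsib = trans (cong (λ g → otherOf (parent x) (otherOf (parent x) x g) f) pe≡) (thirdOf-involutive (parent x) x _ _ f os xf (λ e → px (sym e)))

  module _ (x : Fin n) (≢root : x ≢ r) where
    private R = parent-spec x ≢root
    parent-sibling : parent (sibling x) ≡ parent x
    parent-sibling = trans (cong (lastV r) (trans (cong initSteps (Parent.path-sibling≡ R)) (initSteps-∷ʳ (Parent.prefix R) (Parent.edge R , sibling x)))) (sym (Parent.parent≡ R))
    parentEdge-sibling : parentEdge (sibling x) ≡ Parent.edge R
    parentEdge-sibling = trans (cong lastEdge (Parent.path-sibling≡ R)) (lastEdge-∷ʳ (Parent.prefix R) (Parent.edge R) (sibling x))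
    sibling-sibling : sibling (sibling x) ≡ x
    sibling-sibling = trans (cong₂ (λ u g → otherOf u (sibling x) g) parent-sibling parentEdge-sibling) (Parent.otherOf-sibling R)

  -- Counting the pieces

  centre⇒inI : ∀ x → centre x ≡ true → inI x ≡ true
  centre⇒inI x h = cong (_∨ isLegW x) h

  ¬inI⇒¬centre : ∀ x → inI x ≡ false → centre x ≡ false
  ¬inI⇒¬centre x h = proj₁ (∨-false {centre x} h)

  top≢root : ∀ t → isTop t ≡ true → t ≢ r
  top≢root t h refl with trans (sym h) (cong (λ s → not (inI r) ∧ lastTouchesCentre s) path-root)
  ... | e = false≢true (trans (sym (∧-zeroʳ (not (inI r)))) (sym e))

  top∉I : ∀ t → isTop t ≡ true → inI t ≡ false
  top∉I t h = not-true (proj₁ (∧-true {not (inI t)} h))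

  top-parentEdge-touchesCentre : ∀ t (h : isTop t ≡ true) → touchesCentre (Parent.edge (parent-spec t (top≢root t h))) ≡ true
  top-parentEdge-touchesCentre t h = trans (sym (lastTouchesCentre-∷ʳ (Parent.prefix R) (Parent.edge R) t)) (trans (cong lastTouchesCentre (sym (Parent.path≡ R))) (proj₂ (∧-true {not (inI t)} h)))
    where R = parent-spec t (top≢root t h)

  isTop-intro : ∀ t a f → inI t ≡ false → path t ≡ a ++ [ (f , t) ] → touchesCentre f ≡ true → isTop t ≡ true
  isTop-intro t a f it e hc = cong₂ _∧_ (cong not it) (trans (cong lastTouchesCentre e) (trans (lastTouchesCentre-∷ʳ a f t) hc))

  -- φ u is the top below u reached through the child edge of u; its parent is u.
  φ : Fin n → Fin n
  φ u = vOf u (childEdge u)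

  module _ (u : Fin n) (cu : centre u ≡ true) where
    private
      CE = childEdge-spec u cu
      g = childEdge u
      L = leg u g (proj₁ CE) (proj₁ (proj₂ CE))
    path-φ : path (φ u) ≡ path u ++ [ (g , φ u) ]
    path-φ = path-across-edge g u (proj₁ CE) (proj₁ (proj₂ CE)) (proj₂ (proj₂ CE)) (φ u) (Leg.vf L) (Leg.v≢u L)
    φ-top : isTop (φ u) ≡ true
    φ-top = isTop-intro (φ u) (path u) g (v∉I u g (proj₁ CE) (proj₁ (proj₂ CE)) cu) path-φ (touchesCentre-intro u g (proj₁ (proj₂ CE)) cu)
    parent-φ : parent (φ u) ≡ u
    parent-φ = trans (cong (lastV r) (trans (cong initSteps path-φ) (initSteps-∷ʳ (path u) _))) (path-ends u)

  φ-inj : ∀ u u' → centre u ≡ true → centre u' ≡ true → φ u ≡ φ u' → u ≡ u'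
  φ-inj u u' cu cu' e = trans (sym (parent-φ u cu)) (trans (cong parent e) (parent-φ u' cu'))

  top-sibling-inI : ∀ t → isTop t ≡ true → inI (sibling t) ≡ true
  top-sibling-inI t h with touchesCentre-elim (Parent.edge R) (top-parentEdge-touchesCentre t h)
    where R = parent-spec t (top≢root t h)
  ... | c , cf , cc with ThirdVertex.all (Parent.sibling-third R) c cf
    where R = parent-spec t (top≢root t h)
  ... | inj₂ (inj₁ refl) = ⊥-elim (false≢true (trans (sym (top∉I t h)) (centre⇒inI t cc)))
  ... | inj₂ (inj₂ refl) = centre⇒inI _ cc
  ... | inj₁ refl = wcase (ThirdVertex.all o2 w (Leg.wf L))
    where
    R = parent-spec t (top≢root t h)
    o2 = Parent.sibling-third R
    L = leg (parent t) (Parent.edge R) (Parent.edge∈T R) (Parent.parent∈edge R)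
    w = wOf (parent t) (Parent.edge R)
    wI : inI w ≡ true
    wI = trans (cong (centre w ∨_) (isLegW-complete w (Parent.edge R) (parent t) (Parent.edge∈T R) (Parent.parent∈edge R) cc refl)) (∨-zeroʳ _)
    wcase : w ≡ parent t ⊎ w ≡ t ⊎ w ≡ sibling t → inI (sibling t) ≡ true
    wcase (inj₁ e) = ⊥-elim (Leg.w≢u L e)
    wcase (inj₂ (inj₁ e)) = ⊥-elim (false≢true (trans (sym (top∉I t h)) (trans (cong inI (sym e)) wI)))
    wcase (inj₂ (inj₂ e)) = subst (λ z → inI z ≡ true) e wI

  does-≟-true : ∀ b → does (b Bool.≟ true) ≡ b
  does-≟-true true = refl
  does-≟-true false = refl

  l≡count : l ≡ count isTop
  l≡count = trans (length-filter-tabulate (λ t → isTop t Bool.≟ true) (λ x → x)) (sum-cong-≗ (λ i → cong indicator (does-≟-true (isTop i))))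

  e≡count : length centres ≡ count centre
  e≡count = trans (length-filter-tabulate (λ t → centre t Bool.≟ true) (λ x → x)) (sum-cong-≗ (λ i → cong indicator (does-≟-true (centre i))))

  tops≤I : count isTop ≤ count inI
  tops≤I = count-injection isTop inI sibling top-sibling-inI
    (λ x y hx hy e → trans (sym (sibling-sibling x (top≢root x hx))) (trans (cong sibling e) (sibling-sibling y (top≢root y hy))))

  centres≤tops : count centre ≤ count isTop
  centres≤tops = count-injection centre isTop φ φ-top φ-inj

  CentreFree⇒unblocked : ∀ z s → CentreFree s → unblocked centre z s ≡ true
  CentreFree⇒unblocked z [] _ = refl
  CentreFree⇒unblocked z ((f@(a , b , c) , x) ∷ s) (hf , cf) with ∨-false {centre a} hf
  ... | ca , hbc with ∨-false {centre b} hbc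
  ... | cb , cc rewrite ca | cb | cc | ∧-zeroʳ (not (a == z)) | ∧-zeroʳ (not (b == z)) | ∧-zeroʳ (not (c == z)) = CentreFree⇒unblocked x s cf

  inRegion-of-top : ∀ x t → inI x ≡ false → top x ≡ t → inRegion centre t x ≡ true
  inRegion-of-top x t ix tx with top-spec x ix
  ... | _ , a , e , cf = inRegion-complete centre t x a (subst (λ w → path x ≡ path w ++ a) tx e) (CentreFree⇒unblocked t a cf)

  top-fibre≤K : ∀ t → isTop t ≡ true → count (λ x → not (inI x) ∧ (top x == t)) ≤ K
  top-fibre≤K t h = ≤-trans (count-mono mono) (¬centre⇒small-region t (¬inI⇒¬centre t (top∉I t h)))
    where
    mono : ∀ x → (not (inI x) ∧ (top x == t)) ≡ true → inRegion centre t x ≡ true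
    mono x hx with ∧-true {not (inI x)} hx
    ... | a , b = inRegion-of-top x t (not-true a) (==⇒≡ b)

  ¬I≤K*tops : count (λ x → not (inI x)) ≤ K * count isTop
  ¬I≤K*tops = count-fibres (λ x → not (inI x)) isTop top K (λ x h → proj₁ (top-spec x (not-true h))) top-fibre≤K

  record NonCentreI (x : Fin n) : Set where
    field
      ≢root : x ≢ r
      cases : centre (parent x) ≡ true ⊎ (centre (parent x) ≡ false × centre (sibling x) ≡ true)
      is-w : ∀ u → centre u ≡ true → u ∈ₑ Parent.edge (parent-spec x ≢root) → x ≡ wOf u (Parent.edge (parent-spec x ≢root))

  nonCentreI : ∀ x → inI x ≡ true → centre x ≡ false → NonCentreI x
  nonCentreI x ix cx = record { ≢root = ≢root ; cases = cs (Bool-cases (centre (parent x))) ; is-w = is-w }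
    where
    W = I∖centre⇒leaf-w x ix cx
    f0 = proj₁ W
    u0 = proj₁ (proj₂ W)
    f0T = proj₁ (proj₂ (proj₂ W))
    u0f = proj₁ (proj₂ (proj₂ (proj₂ W)))
    cu0 = proj₁ (proj₂ (proj₂ (proj₂ (proj₂ W))))
    ex = proj₁ (proj₂ (proj₂ (proj₂ (proj₂ (proj₂ W)))))
    dx = proj₂ (proj₂ (proj₂ (proj₂ (proj₂ (proj₂ W)))))
    ≢root : x ≢ r
    ≢root e = false≢true (trans (sym cx) (trans (cong centre e) centre-root))
    R = parent-spec x ≢root
    f = Parent.edge R
    ff : f0 ≡ f
    ff = leaf-edge-unique x f0 f dx f0T (Parent.edge∈T R) (subst (_∈ₑ f0) (sym ex) (Leg.wf (leg u0 f0 f0T u0f))) (Parent.x∈edge R)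
    u0f' : u0 ∈ₑ f
    u0f' = subst (u0 ∈ₑ_) ff u0f
    cs : centre (parent x) ≡ true ⊎ centre (parent x) ≡ false → centre (parent x) ≡ true ⊎ (centre (parent x) ≡ false × centre (sibling x) ≡ true)
    cs (inj₁ h) = inj₁ h
    cs (inj₂ h) with ThirdVertex.all (Parent.sibling-third R) u0 u0f'
    ... | inj₁ e = ⊥-elim (false≢true (trans (sym h) (trans (cong centre (sym e)) cu0)))
    ... | inj₂ (inj₁ e) = ⊥-elim (false≢true (trans (sym cx) (trans (cong centre (sym e)) cu0)))
    ... | inj₂ (inj₂ e) = inj₂ (h , trans (cong centre (sym e)) cu0)
    is-w : ∀ u → centre u ≡ true → u ∈ₑ f → x ≡ wOf u f
    is-w u cu uf with u0 ≟ u
    ... | yes refl = subst (λ g → x ≡ wOf u0 g) ff ex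
    ... | no ne = ⊥-elim (false≢true (trans (sym cx) (trans (cong centre (trans ex (w-is-centre u0 f0 f0T u0f cu0 u (subst (u ∈ₑ_) (sym ff) uf) (λ e → ne (sym e)) cu))) cu)))

  sibling∉I : ∀ x (≢root : x ≢ r) → inI x ≡ true → centre (parent x) ≡ true → inI (sibling x) ≡ false
  sibling∉I x ≢root ix cp = locate-v (ThirdVertex.all (Parent.sibling-third R) v (Leg.vf L))
    where
    R = parent-spec x ≢root
    L = leg (parent x) (Parent.edge R) (Parent.edge∈T R) (Parent.parent∈edge R)
    v = vOf (parent x) (Parent.edge R)
    w3 : inI v ≡ false
    w3 = v∉I (parent x) (Parent.edge R) (Parent.edge∈T R) (Parent.parent∈edge R) cp
    locate-v : v ≡ parent x ⊎ v ≡ x ⊎ v ≡ sibling x → inI (sibling x) ≡ false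
    locate-v (inj₁ e) = ⊥-elim (Leg.v≢u L e)
    locate-v (inj₂ (inj₁ e)) = ⊥-elim (false≢true (trans (sym w3) (trans (cong inI e) ix)))
    locate-v (inj₂ (inj₂ e)) = subst (λ z → inI z ≡ false) e w3

  -- Only parent t, sibling t and sibling (parent t) are sent to a top t.
  ψ : Fin n → Fin n
  ψ x = if centre x then φ x else (if centre (parent x) then sibling x else φ (sibling x))

  ψ-centre : ∀ x → centre x ≡ true → ψ x ≡ φ x
  ψ-centre x h = cong (λ b → if b then φ x else (if centre (parent x) then sibling x else φ (sibling x))) h

  ψ-non-centre : ∀ x → centre x ≡ false → ψ x ≡ (if centre (parent x) then sibling x else φ (sibling x))
  ψ-non-centre x h = cong (λ b → if b then φ x else (if centre (parent x) then sibling x else φ (sibling x))) h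

  ψ-top : ∀ x → inI x ≡ true → isTop (ψ x) ≡ true
  ψ-top x ix = by-centre (Bool-cases (centre x))
    where
    by-centre : centre x ≡ true ⊎ centre x ≡ false → isTop (ψ x) ≡ true
    by-centre (inj₁ cx) = subst (λ z → isTop z ≡ true) (sym (ψ-centre x cx)) (φ-top x cx)
    by-centre (inj₂ cx) = by-parent (NonCentreI.cases N)
      where
      N = nonCentreI x ix cx
      ≢root = NonCentreI.≢root N
      R = parent-spec x ≢root
      by-parent : centre (parent x) ≡ true ⊎ (centre (parent x) ≡ false × centre (sibling x) ≡ true) → isTop (ψ x) ≡ true
      by-parent (inj₁ cp) = subst (λ z → isTop z ≡ true) (sym (trans (ψ-non-centre x cx) (if-true (sibling x) (φ (sibling x)) cp)))
        (isTop-intro (sibling x) (Parent.prefix R) (Parent.edge R) (sibling∉I x ≢root ix cp) (Parent.path-sibling≡ R) (touchesCentre-intro (parent x) (Parent.edge R) (Parent.parent∈edge R) cp))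
      by-parent (inj₂ (cp , cs)) = subst (λ z → isTop z ≡ true) (sym (trans (ψ-non-centre x cx) (if-false (sibling x) (φ (sibling x)) cp))) (φ-top (sibling x) cs)

  ψ-fibre≤3 : ∀ t → isTop t ≡ true → count (λ x → inI x ∧ (ψ x == t)) ≤ 3
  ψ-fibre≤3 t _ = count-≤3 _ (parent t) (sibling t) (sibling (parent t)) h
    where
    h : ∀ x → (inI x ∧ (ψ x == t)) ≡ true → x ≡ parent t ⊎ x ≡ sibling t ⊎ x ≡ sibling (parent t)
    h x hx = by-centre (Bool-cases (centre x))
      where
      ix : inI x ≡ true
      ix = proj₁ (∧-true {inI x} hx)
      e : ψ x ≡ t
      e = ==⇒≡ (proj₂ (∧-true {inI x} hx))
      by-centre : centre x ≡ true ⊎ centre x ≡ false → x ≡ parent t ⊎ x ≡ sibling t ⊎ x ≡ sibling (parent t)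
      by-centre (inj₁ cx) = inj₁ (trans (sym (parent-φ x cx)) (cong parent (trans (sym (ψ-centre x cx)) e)))
      by-centre (inj₂ cx) = by-parent (NonCentreI.cases N)
        where
        N = nonCentreI x ix cx
        by-parent : centre (parent x) ≡ true ⊎ (centre (parent x) ≡ false × centre (sibling x) ≡ true) → x ≡ parent t ⊎ x ≡ sibling t ⊎ x ≡ sibling (parent t)
        by-parent (inj₁ cp) = inj₂ (inj₁ (trans (sym (sibling-sibling x (NonCentreI.≢root N))) (cong sibling (trans (sym (trans (ψ-non-centre x cx) (if-true (sibling x) (φ (sibling x)) cp))) e))))
        by-parent (inj₂ (cp , cs)) = inj₂ (inj₂ (trans (sym (sibling-sibling x (NonCentreI.≢root N)))
            (cong sibling (trans (sym (parent-φ (sibling x) cs)) (cong parent (trans (sym (trans (ψ-non-centre x cx) (if-false (sibling x) (φ (sibling x)) cp))) e))))))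

  I≤3*tops : count inI ≤ 3 * count isTop
  I≤3*tops = count-fibres inI isTop ψ 3 ψ-top ψ-fibre≤3

  n≡I+¬I : n ≡ count inI + count (λ x → not (inI x))
  n≡I+¬I = trans (sym count-const-true) (count-split (λ _ → true) inI)

  n≤[K+3]*tops : n ≤ (K + 3) * count isTop
  n≤[K+3]*tops = ≤-trans (≤-reflexive n≡I+¬I)
    (≤-trans (+-mono-≤ I≤3*tops ¬I≤K*tops)
      (≤-reflexive (trans (+-comm (3 * count isTop) _) (sym (*-distribʳ-+ (count isTop) K 3)))))

  -- γ sends x ∈ I to the centre of a star containing x; besides u, only the w of an edge at u goes to u.
  γ : Fin n → Fin n
  γ x = if centre x then x else (if centre (parent x) then parent x else sibling x)

  γ-centre : ∀ x → inI x ≡ true → centre (γ x) ≡ true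
  γ-centre x ix = by-centre (Bool-cases (centre x))
    where
    by-centre : centre x ≡ true ⊎ centre x ≡ false → centre (γ x) ≡ true
    by-centre (inj₁ cx) = trans (cong centre (if-true x _ cx)) cx
    by-centre (inj₂ cx) = by-parent (NonCentreI.cases (nonCentreI x ix cx))
      where
      by-parent : centre (parent x) ≡ true ⊎ (centre (parent x) ≡ false × centre (sibling x) ≡ true) → centre (γ x) ≡ true
      by-parent (inj₁ cp) = trans (cong centre (trans (if-false x _ cx) (if-true (parent x) (sibling x) cp))) cp
      by-parent (inj₂ (cp , cs)) = trans (cong centre (trans (if-false x _ cx) (if-false (parent x) (sibling x) cp))) cs

  module γ-fibre (u : Fin n) (cu : centre u ≡ true) where
    edgeIndex : Fin n → Fin (suc (deg T u))
    edgeIndex x = Maybe.maybe suc zero (indexOf _≟E_ (edgesAt u) (parentEdge x))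

    edgeIndex-spec : ∀ x → parentEdge x ∈ edgesAt u →
      ∃ λ j → edgeIndex x ≡ suc j × parentEdge x ≡ lookup (edgesAt u) j
    edgeIndex-spec x m with indexOf-complete _≟E_ (edgesAt u) (parentEdge x) m
    ... | j , found = j , cong (Maybe.maybe suc zero) found , sym (indexOf-sound _≟E_ (edgesAt u) (parentEdge x) found)

    code : Fin n → Fin (suc (deg T u))
    code x = if x == u then zero else edgeIndex x

    InFibre : Fin n → Bool
    InFibre x = inI x ∧ γ x == u

    InFibre-leg : ∀ x → InFibre x ≡ true → x ≢ u → parentEdge x ∈ edgesAt u × x ≡ wOf u (parentEdge x)
    InFibre-leg x hx x≢u with ∧-true {inI x} hx | Bool-cases (centre x)
    ... | _ , γx≡u | inj₁ cx = ⊥-elim (x≢u (trans (sym (if-true x _ cx)) (==⇒≡ γx≡u)))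
    ... | ix , γx≡u | inj₂ cx =
      subst (_∈ edgesAt u) (sym (Parent.parentEdge≡ R)) (∈-filter⁺ (u ∈ₑ?_) (Parent.edge∈T R) uf) ,
      trans (NonCentreI.is-w N u cu uf) (cong (wOf u) (sym (Parent.parentEdge≡ R)))
      where
      N = nonCentreI x ix cx
      R = parent-spec x (NonCentreI.≢root N)
      γ≡ : γ x ≡ u
      γ≡ = ==⇒≡ γx≡u
      uf : u ∈ₑ Parent.edge R
      uf with NonCentreI.cases N
      ... | inj₁ cp = subst (_∈ₑ Parent.edge R) (trans (sym (if-true (parent x) (sibling x) cp)) (trans (sym (if-false x _ cx)) γ≡)) (Parent.parent∈edge R)
      ... | inj₂ (cp , _) = subst (_∈ₑ Parent.edge R) (trans (sym (if-false (parent x) (sibling x) cp)) (trans (sym (if-false x _ cx)) γ≡)) (ThirdVertex.∈f (Parent.sibling-third R))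

    code-leg : ∀ z → z ≢ u → InFibre z ≡ true →
      ∃ λ j → edgeIndex z ≡ suc j × parentEdge z ≡ lookup (edgesAt u) j × z ≡ wOf u (parentEdge z)
    code-leg z z≢u hz with InFibre-leg z hz z≢u
    ... | m , z≡w with edgeIndex-spec z m
    ... | j , idx , pe≡ = j , idx , pe≡ , z≡w

    code-injective : ∀ x y → InFibre x ≡ true → InFibre y ≡ true → code x ≡ code y → x ≡ y
    code-injective x y hx hy e with x ≟ u | y ≟ u
    ... | yes x≡u | yes y≡u = trans x≡u (sym y≡u)
    ... | yes _ | no y≢u = ⊥-elim (0≢1+n (trans e (proj₁ (proj₂ (code-leg y y≢u hy)))))
    ... | no x≢u | yes _ = ⊥-elim (0≢1+n (trans (sym e) (proj₁ (proj₂ (code-leg x x≢u hx)))))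
    ... | no x≢u | no y≢u with code-leg x x≢u hx | code-leg y y≢u hy
    ... | j , cx , px , x≡w | j′ , cy , py , y≡w = begin
      x                        ≡⟨ x≡w ⟩
      wOf u (parentEdge x)     ≡⟨ cong (wOf u) (trans px (trans (cong (lookup (edgesAt u)) j≡j′) (sym py))) ⟩
      wOf u (parentEdge y)     ≡⟨ y≡w ⟨
      y                        ∎
      where
      open ≡-Reasoning
      j≡j′ : j ≡ j′
      j≡j′ = suc-injective (trans (sym cx) (trans e cy))

    fibre≤ : count InFibre ≤ suc (deg T u)
    fibre≤ = ≤-trans (count-injection InFibre (λ _ → true) code (λ _ _ → refl) code-injective) (≤-reflexive count-const-true)

  I≤[d+1]*centres : ∀ d → (∀ x → deg T x ≤ d) → count inI ≤ suc d * count centre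
  I≤[d+1]*centres d dB = count-fibres inI centre γ (suc d) γ-centre (λ u cu → ≤-trans (γ-fibre.fibre≤ u cu) (s≤s (dB u)))

  unblocked-++⁻ : ∀ x (a b : List (Step {n})) → unblocked centre x (a ++ b) ≡ true → unblocked centre (lastV x a) b ≡ true
  unblocked-++⁻ x [] b h = h
  unblocked-++⁻ x ((f , z) ∷ a) b h = unblocked-++⁻ z a b (proj₂ (∧-true {not (blocked centre x f)} h))

  blocked-by-centre : ∀ z0 f z → z ∈ₑ f → z ≢ z0 → centre z ≡ true → blocked centre z0 f ≡ true
  blocked-by-centre z0 (a , b , c) z (inj₁ refl) ne cz rewrite ==-≢ ne | cz = refl
  blocked-by-centre z0 (a , b , c) z (inj₂ (inj₁ refl)) ne cz rewrite ==-≢ ne | cz = ∨-zeroʳ _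
  blocked-by-centre z0 (a , b , c) z (inj₂ (inj₂ refl)) ne cz rewrite ==-≢ ne | cz =
    trans (cong ((not (a == z0) ∧ centre a) ∨_) (∨-zeroʳ _)) (∨-zeroʳ _)

  no-centre-below-in-region : ∀ y u u' (e s s' : List (Step {n})) → centre u' ≡ true → path u' ≡ path u ++ e → path y ≡ path u ++ s →
       path y ≡ path u' ++ s' → unblocked centre u s ≡ true → u ≡ u'
  no-centre-below-in-region y u u' [] s s' cu' pe' py py' ub = trans (sym (path-ends u)) (trans (cong (lastV r) (sym (trans pe' (++-identityʳ _)))) (path-ends u'))
  no-centre-below-in-region y u u' e@(_ ∷ _) s s' cu' pe' py py' ub = ⊥-elim (false≢true (trans (sym bf) bt))
    where
    LV = init-last e (λ ())
    e0 = proj₁ LV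
    f = proj₁ (proj₁ (proj₂ LV))
    z = proj₂ (proj₁ (proj₂ LV))
    ee : e ≡ e0 ++ [ (f , z) ]
    ee = proj₂ (proj₂ LV)
    q = path u ++ e0
    pu' : path u' ≡ q ++ [ (f , z) ]
    pu' = trans pe' (trans (cong (path u ++_) ee) (sym (++-assoc (path u) e0 _)))
    zu' : z ≡ u'
    zu' = trans (sym (lastV-++ r q [ (f , z) ])) (trans (cong (lastV r) (sym pu')) (path-ends u'))
    SA = path-step u' q f z [] pu'
    u'f : u' ∈ₑ f
    u'f = subst (_∈ₑ f) zu' (proj₂ (proj₂ SA))
    z0 = lastV r q
    pz0 : path z0 ≡ q
    pz0 = path-prefix u' q _ pu'
    ne : u' ≢ z0
    ne h = ∷ʳ-length-≢ q (f , z) (trans (sym pz0) (trans (cong path (sym h)) pu'))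
    ss : s ≡ e ++ s'
    ss = ++-cancelˡ (path u) s (e ++ s') (trans (sym py) (trans py' (trans (cong (_++ s') pe') (++-assoc (path u) e s'))))
    s2 : s ≡ e0 ++ (f , z) ∷ s'
    s2 = trans ss (trans (cong (_++ s') ee) (++-assoc e0 [ (f , z) ] s'))
    ub2 : unblocked centre (lastV u e0) ((f , z) ∷ s') ≡ true
    ub2 = unblocked-++⁻ u e0 _ (subst (λ w → unblocked centre u w ≡ true) s2 ub)
    lz0 : lastV u e0 ≡ z0
    lz0 = trans (cong (λ w → lastV w e0) (sym (path-ends u))) (sym (lastV-++ r (path u) e0))
    bf : blocked centre z0 f ≡ false
    bf = subst (λ w → blocked centre w f ≡ false) lz0 (not-true (proj₁ (∧-true {not (blocked centre (lastV u e0) f)} ub2)))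
    bt : blocked centre z0 f ≡ true
    bt = blocked-by-centre z0 f u' u'f ne cu'

  nonRootCentre : Fin n → Bool
  nonRootCentre u = centre u ∧ not (u == r)

  regions-disjoint : ∀ y u u' → centre u ≡ true → centre u' ≡ true → inRegion centre u y ≡ true → inRegion centre u' y ≡ true → u ≡ u'
  regions-disjoint y u u' cu cu' h h' = by-prefix-order (++-prefixes-comparable (path u) s (path u') s' (trans (sym py) py'))
    where
    S1 = inRegion-sound centre u y h
    S2 = inRegion-sound centre u' y h'
    s = proj₁ S1
    s' = proj₁ S2
    py = proj₁ (proj₂ S1)
    py' = proj₁ (proj₂ S2)
    by-prefix-order : (∃ λ e → path u' ≡ path u ++ e) ⊎ (∃ λ e → path u ≡ path u' ++ e) → u ≡ u'
    by-prefix-order (inj₁ (e , pe')) = no-centre-below-in-region y u u' e s s' cu' pe' py py' (proj₂ (proj₂ S1))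
    by-prefix-order (inj₂ (e , pe')) = sym (no-centre-below-in-region y u' u e s' s cu pe' py' py (proj₂ (proj₂ S2)))

  nonRootCentre-region : ∀ u → indicator (nonRootCentre u) * suc K ≤ sum (λ y → indicator (nonRootCentre u ∧ inRegion centre u y))
  nonRootCentre-region u with nonRootCentre u in q
  ... | false = z≤n
  ... | true = ≤-trans (≤-reflexive (*-identityˡ (suc K)))
                 (centre⇒large-region u (proj₁ (∧-true {centre u} q)) (λ e → false≢true (trans (sym (cong not (trans (cong (λ w → (u == w)) refl) (eqT e)))) (proj₂ (∧-true {centre u} q)))))
    where
    eqT : u ≡ r → (u == r) ≡ true
    eqT refl = ==-refl u

  -- Regions of distinct non-root centres are disjoint, and each has more than K vertices.
  regions-fill : suc K * count nonRootCentre ≤ n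
  regions-fill = begin
    suc K * count nonRootCentre ≡⟨ *-distribˡ-sum (suc K) (λ u → indicator (nonRootCentre u)) ⟩
    sum (λ u → suc K * indicator (nonRootCentre u)) ≤⟨ sum-mono-≤ (λ u → ≤-trans (≤-reflexive (*-comm (suc K) (indicator (nonRootCentre u)))) (nonRootCentre-region u)) ⟩
    sum (λ u → sum (λ y → indicator (nonRootCentre u ∧ inRegion centre u y))) ≡⟨ ∑-comm (λ u y → indicator (nonRootCentre u ∧ inRegion centre u y)) ⟩
    sum (λ y → sum (λ u → indicator (nonRootCentre u ∧ inRegion centre u y))) ≤⟨ sum-mono-≤ (λ y → count-≤1 (λ u → nonRootCentre u ∧ inRegion centre u y) (dj y)) ⟩
    sum {n} (λ y → 1) ≡⟨ count-const-true ⟩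
    n ∎
    where
    open ≤-Reasoning
    dj : ∀ y a b → (nonRootCentre a ∧ inRegion centre a y) ≡ true → (nonRootCentre b ∧ inRegion centre b y) ≡ true → a ≡ b
    dj y a b ha hb = regions-disjoint y a b (proj₁ (∧-true {centre a} (proj₁ (∧-true {nonRootCentre a} ha)))) (proj₁ (∧-true {centre b} (proj₁ (∧-true {nonRootCentre b} hb))))
                       (proj₂ (∧-true {nonRootCentre a} ha)) (proj₂ (∧-true {nonRootCentre b} hb))

  centres≤nonRoot+1 : count centre ≤ count nonRootCentre + 1
  centres≤nonRoot+1 = ≤-trans (≤-reflexive (count-split centre (λ x → not (x == r))))
             (+-monoʳ-≤ (count nonRootCentre) (count-≤1 _ one))
    where
    nn : ∀ x → not (not (x == r)) ≡ true → x ≡ r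
    nn x h with (x == r) in q
    ... | true = ==⇒≡ q
    nn x () | false
    one : ∀ a b → (centre a ∧ not (not (a == r))) ≡ true → (centre b ∧ not (not (b == r))) ≡ true → a ≡ b
    one a b ha hb = trans (nn a (proj₂ (∧-true {centre a} ha))) (sym (nn b (proj₂ (∧-true {centre b} hb))))

  partSize≤K : ∀ p → length (filter (λ x → Maybeₚ.≡-dec _≟_ (part x) (just p)) (allFin n)) ≤ K
  partSize≤K p = ≤-trans (≤-reflexive (length-filter-tabulate (λ x → Maybeₚ.≡-dec _≟_ (part x) (just p)) (λ x → x)))
              (≤-trans (count-mono mono) (¬centre⇒small-region t (¬inI⇒¬centre t (top∉I t (tops-isTop p)))))
    where
    t = lookup tops p
    mono : ∀ x → does (Maybeₚ.≡-dec _≟_ (part x) (just p)) ≡ true → inRegion centre t x ≡ true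
    mono x h with part-just x p (does⇒ (Maybeₚ.≡-dec _≟_ (part x) (just p)) h)
    ... | ix , tx = inRegion-of-top x t ix tx

  decomposition : ∀ d → (∀ x → deg T x ≤ d) → K ≤ n → Decomposition d K n T
  decomposition d deg≤d K≤n = record
    { e = length centres ; center = centreAt ; center-inj = lookup-injective centres centres-Unique
    ; legs = legs ; isStar = λ j → centre-star (centreAt j) (centreAt-centre j)
    ; l = l ; I = I ; part = part ; part-I = part-I ; I-part = I-part ; part-nonempty = part-nonempty
    ; I-isolated = I-isolated ; edge-inside = edge-inside ; part-tree = PartTree.tree
    ; cond1 = partSize≤K
    ; cond2 = subst (λ i → K * i ≤ 2 * (d * d) * n) (sym (∣tabulate∣≡count inI))
                (cond2-arithmetic (≤-trans deg-r≥2 (deg≤d r)) K≤n (I≤[d+1]*centres d deg≤d) centres≤nonRoot+1 regions-fill)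
    ; cond3 = subst₂ _≤_ (sym l≡count) (sym (∣tabulate∣≡count inI)) tops≤I
    ; cond4 = subst₂ _≤_ (sym e≡count) (sym l≡count) centres≤tops
    ; cond5 = subst (λ t → n ≤ (K + 3) * t) (sym l≡count) n≤[K+3]*tops
    ; cond6a = cond6a ; cond6b = cond6b ; cond6c = cond6c ; cond6d = cond6d }

-- If every vertex had degree at most one, all vertices would lie in the edge through
-- vertex 0 and vertex 1, so there would be at most three of them.
branching-vertex : ∀ {n} (T : Hypergraph3 n) → IsHypertree T → 4 ≤ n → ∃ λ r → 2 ≤ deg T r
branching-vertex {suc zero} T HT (s≤s ())
branching-vertex {suc (suc m)} T HT 4≤n with any? (λ x → 2 ≤? deg T x)
... | yes found = found
... | no none =
  ⊥-elim (<⇒≱ 4≤n (≤-trans (≤-reflexive (sym count-const-true)) (count-≤3 (λ _ → true) a b c (λ y _ → in-f₀ y))))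
  where
  open HypertreeFacts T HT
  edge-from-0 : ∀ y → y ≢ zero → ∃ λ e → e ∈ edges T × zero ∈ₑ e × y ∈ₑ e
  edge-from-0 y y≢0 with connected zero y
  ... | [] , _ , l , _ = ⊥-elim (y≢0 (sym l))
  ... | (e₁ , _) ∷ [] , (h , a , b , _) , l , _ = e₁ , h , a , subst (_∈ₑ e₁) l b
  ... | (e₁ , y₁) ∷ (e₂ , _) ∷ _ , (h₁ , _ , b , h₂ , a₂ , _) , _ , _ , u =
    ⊥-elim (none (y₁ , two-edges⇒deg≥2 y₁ e₁ e₂ h₁ h₂ b a₂ (λ e → Uniqueₚ.Unique[x∷xs]⇒x∉xs u (here e))))
  F₀ = edge-from-0 (suc zero) (λ ())
  f₀ = proj₁ F₀
  a = proj₁ f₀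
  b = proj₁ (proj₂ f₀)
  c = proj₂ (proj₂ f₀)
  in-f₀ : ∀ y → y ∈ₑ f₀
  in-f₀ y with y ≟ zero
  ... | yes refl = proj₁ (proj₂ (proj₂ F₀))
  ... | no y≢0 with edge-from-0 y y≢0
  ... | e , eT , 0∈e , y∈e with e ≟E f₀
  ... | yes refl = y∈e
  ... | no e≢f₀ = ⊥-elim (none (zero , two-edges⇒deg≥2 zero e f₀ eT (proj₁ (proj₂ F₀)) 0∈e (proj₁ (proj₂ (proj₂ F₀))) e≢f₀))

-- Any k ≥ 1 and n ≥ k + 4 work.
lemma2p2 : ∀ (d : ℕ) → 1 ≤ d →
    ∃ λ k₀ → ∀ (k : ℕ) → k₀ ≤ k →
    ∃ λ n₀ → ∀ (n : ℕ) → n₀ ≤ n →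
    (T : Hypergraph3 n) → IsSubdivisionTree T → (∀ x → deg T x ≤ d) →
    Decomposition d k n T
lemma2p2 d _ = 1 , λ k 1≤k → k + 4 , λ n k+4≤n T (isTree , has-leaf) deg≤d →
  let (r , deg-r≥2) = branching-vertex T isTree (≤-trans (m≤n+m 4 k) k+4≤n)
  in Construction.decomposition T isTree has-leaf r deg-r≥2 k 1≤k d deg≤d (≤-trans (m≤m+n k 4) k+4≤n)
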